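{- Let $G$ be a $1$-walk regular graph with adjacency matrix $A$ and degree matrix $D$, and fix a sign $\pm$. For vertices $u_1,v_1,\ldots,u_r,v_r$ all lying in a common clique $K$ of $G$, consider the rational function (in $t,\mu$) $$e_{u_r}^\top\Big(tI-A+\mu D\pm\big(\epsilon_{u_1,v_1}e_{u_1}e_{v_1}^\top+\cdots+\epsilon_{u_{r-1},v_{r-1}}e_{u_{r-1}}e_{v_{r-1}}^\top\big)\Big)^{ -1}e_{v_r}.$$ Its value is independent of the choice of the clique and of the ordering of the vertices of the chosen clique: if $K'$ is any clique of $G$ and $\sigma:K\to K'$ is any injective map, then the value for $(u_1,v_1,\ldots,u_r,v_r)$ equals the value for $(\sigma(u_1),\sigma(v_1),\ldots,\sigma(u_r),\sigma(v_r))$.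
   Context: All graphs are finite and simple. A graph is walk regular if for every positive integer $k$ the number of closed walks of length $k$ starting at a vertex is the same for all vertices; it is $1$-walk regular if it is walk regular and, moreover, for every $k$ the number of walks of length $k$ from $u$ to $v$ is the same for all pairs of adjacent vertices $u,v$. For vertices $u,v$, $\delta_{u,v}$ is the Kronecker delta, $e_u$ is the standard basis column vector indexed by vertex $u$, and $\epsilon_{u,v}:=-\mu\,\delta_{u,v}+(1-\delta_{u,v})$. Here $t,\mu$ are indeterminates, and matrices are regarded over the field $\mathbb{Q}(t,\mu)$. -}

module Defs where

open import Data.Bool using (Bool; true; false; if_then_else_; _∧_)
open import Data.Nat as ℕ using (ℕ; zero; suc)
open import Data.Integer using (+_)
open import Data.Rational as Q using (ℚ; 0ℚ; 1ℚ)
open import Data.Fin using (Fin)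
open import Data.Fin.Properties using () renaming (_≟_ to _≟ᶠ_)
open import Data.Fin.Subset using (Subset; _∈_)
open import Data.List using (List; []; _∷_; map; foldr; allFin)
open import Data.List.Relation.Unary.All using (All)
open import Relation.Nullary using (¬_; does)
open import Data.Product using (_×_)
open import Relation.Binary.PropositionalEquality using (_≡_; _≢_)

record Graph (n : ℕ) : Set where
  field
    Adj   : Fin n → Fin n → Bool
    sym   : ∀ x y → Adj x y ≡ Adj y x
    irrefl : ∀ x → Adj x x ≡ false
open Graph public

Σᶠ : ∀ {n} {A : Set} → A → (A → A → A) → (Fin n → A) → A
Σᶠ {n} z _⊕_ f = foldr (λ i acc → f i ⊕ acc) z (allFin n)

eqᵇ : ∀ {n} → Fin n → Fin n → Bool
eqᵇ x y = does (x ≟ᶠ y)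

walks : ∀ {n} → Graph n → ℕ → Fin n → Fin n → ℕ
walks G zero    u v = if eqᵇ u v then 1 else 0
walks G (suc k) u v = Σᶠ 0 ℕ._+_ (λ w → if Adj G u w then walks G k w v else 0)

degree : ∀ {n} → Graph n → Fin n → ℕ
degree G u = Σᶠ 0 ℕ._+_ (λ w → if Adj G u w then 1 else 0)

WalkRegular : ∀ {n} → Graph n → Set
WalkRegular G = ∀ k u v → walks G (suc k) u u ≡ walks G (suc k) v v

OneWalkRegular : ∀ {n} → Graph n → Set
OneWalkRegular G =
  WalkRegular G × (∀ k u v u' v' → Adj G u v ≡ true → Adj G u' v' ≡ true →
                      walks G k u v ≡ walks G k u' v')

IsClique : ∀ {n} → Graph n → Subset n → Set
IsClique G K = ∀ x y → x ∈ K → y ∈ K → x ≢ y → Adj G x y ≡ true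

-- Polynomials (coefficient lists, lowest degree first) over a raw ring

module PolyOps {A : Set} (_+_ _*_ : A → A → A) (-_ : A → A) (0# : A) where
  _⊕_ : List A → List A → List A
  []      ⊕ q       = q
  (a ∷ p) ⊕ []      = a ∷ p
  (a ∷ p) ⊕ (b ∷ q) = (a + b) ∷ (p ⊕ q)

  neg : List A → List A
  neg = map -_

  _⊗_ : List A → List A → List A
  []      ⊗ q = []
  (a ∷ p) ⊗ q = map (a *_) q ⊕ (0# ∷ (p ⊗ q))

P1 : Set
P1 = List ℚ

module P1ops = PolyOps Q._+_ Q._*_ Q.-_ 0ℚ

IsZero₁ : P1 → Set
IsZero₁ p = All (_≡ 0ℚ) p

-- ℚ[t][μ] = ℚ[t,μ] : polynomials in μ with coefficients in ℚ[t]
P2 : Set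
P2 = List P1

module P2ops = PolyOps P1ops._⊕_ P1ops._⊗_ P1ops.neg []
open P2ops public using (_⊕_; _⊗_; neg)

IsZero₂ : P2 → Set
IsZero₂ p = All IsZero₁ p

_≈ᴾ_ : P2 → P2 → Set
p ≈ᴾ q = IsZero₂ (p ⊕ neg q)

constP : ℚ → P2
constP c = (c ∷ []) ∷ []

tP μP : P2
tP = (0ℚ ∷ 1ℚ ∷ []) ∷ []
μP = [] ∷ (1ℚ ∷ []) ∷ []

-- The field ℚ(t,μ): fractions num/den with den ≠ 0 (validity is a
-- separate predicate; operations are the usual fraction-field formulas)

record Frac : Set where
  constructor _∕_
  field
    num den : P2
open Frac public

Valid : Frac → Set
Valid f = ¬ IsZero₂ (den f)

_≈ᶠ_ : Frac → Frac → Set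
(a ∕ b) ≈ᶠ (c ∕ d) = (a ⊗ d) ≈ᴾ (c ⊗ b)

_+ᶠ_ : Frac → Frac → Frac
(a ∕ b) +ᶠ (c ∕ d) = ((a ⊗ d) ⊕ (c ⊗ b)) ∕ (b ⊗ d)

_*ᶠ_ : Frac → Frac → Frac
(a ∕ b) *ᶠ (c ∕ d) = (a ⊗ c) ∕ (b ⊗ d)

ofP : P2 → Frac
ofP p = p ∕ constP 1ℚ

0ᶠ 1ᶠ : Frac
0ᶠ = ofP []
1ᶠ = ofP (constP 1ℚ)

Mat : ℕ → Set
Mat n = Fin n → Fin n → Frac

_·_ : ∀ {n} → Mat n → Mat n → Mat n
(M · N) u w = Σᶠ 0ᶠ _+ᶠ_ (λ v → M u v *ᶠ N v w)

IsIdentity : ∀ {n} → Mat n → Set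
IsIdentity M = ∀ u w → M u w ≈ᶠ (if eqᵇ u w then 1ᶠ else 0ᶠ)

IsInverse : ∀ {n} → Mat n → Mat n → Set
IsInverse M N = (∀ u w → Valid (N u w)) × (IsIdentity (M · N) × IsIdentity (N · M))

εP : ∀ {n} → Fin n → Fin n → P2
εP u v = if eqᵇ u v then neg μP else constP 1ℚ

signP : Bool → P2 → P2
signP true  p = p
signP false p = neg p

-- t I - A + μ D ± (Σ_{i<m} ε_{u_i,v_i} e_{u_i} e_{v_i}^T)
pertMatrix : ∀ {n} → Graph n → Bool → (m : ℕ) → (Fin m → Fin n) → (Fin m → Fin n) → Mat n
pertMatrix G s m us vs x y = ofP (diag ⊕ (adj ⊕ signP s pert))
  where
  diag = if eqᵇ x y then tP ⊕ (μP ⊗ constP (+ degree G x Q./ 1)) else []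
  adj  = if Adj G x y then constP (Q.- 1ℚ) else []
  pert = Σᶠ [] _⊕_ (λ i → if eqᵇ x (us i) ∧ eqᵇ y (vs i) then εP (us i) (vs i) else [])

-- A walk-regular graph is regular, say of degree d, so the perturbed matrix is t I − B with
-- B = A − μ d I ∓ Σ εᵢ e_{uᵢ} e_{vᵢ}ᵀ free of t.  Clearing the denominators of row r of the
-- inverse gives polynomials x̃ and c ≠ 0 with x̃ (t I − B) = c e_r, so y_L = (x̃ B^L)_v satisfies
-- y_{L+1} = t y_L − c (B^L)_{rv}.  By 1-walk-regularity the entries of A^j on a clique depend only
-- on whether the two vertices coincide, hence (by induction on k) so do those of A^j B^k, and
-- (B^L)_{rv} equals the entry (B′^L)_{σr,σv} of the σ-image.  Hence c′ y_L − c y′_L is multiplied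
-- by t at every step while its t-degree stays bounded, so it vanishes; at L = 0 this says
-- c′ x̃_v = c x̃′_{σ v}, which is the equality of the two entries of the inverses.

module Submission where

open import Level using (0ℓ)
open import Algebra.Bundles using (CommutativeMonoid; CommutativeRing)
open import Data.Bool using (Bool; true; false; if_then_else_; _∧_)
open import Data.Empty using (⊥-elim)
open import Data.Fin using (Fin; zero; suc)
open import Data.List using (List; []; _∷_; map; length; tabulate)
import Data.List as List
open import Data.List.Relation.Unary.All using (All; []; _∷_)
open import Data.Nat as ℕ using (ℕ; zero; suc; s≤s; z≤n)
import Data.Nat.Properties as ℕₚ
open import Data.Product using (_,_; ∃; proj₁; proj₂)
open import Data.Sum using (_⊎_; inj₁; inj₂; [_,_])
import Data.Vec.Functional as Vector
open import Function using (_∘_)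
open import Relation.Nullary using (Dec; yes; no; ¬_)
open import Relation.Binary.PropositionalEquality as ≡ using (_≡_)

open import Data.Fin.Properties using (_≟_)
open import Data.Fin.Subset using (Subset; _∈_)
open import Data.Integer using (+_)
open import Data.Rational as ℚ using (0ℚ; 1ℚ)
import Data.Rational.Properties as ℚₚ
open import Relation.Nullary.Decidable using (dec-true; dec-false)

open import Defs hiding (sym; _⊕_; _⊗_; neg)

module Polynomial {ℓ} (R : CommutativeRing 0ℓ ℓ) where
  open CommutativeRing R renaming (Carrier to A) hiding (zero)
  open PolyOps _+_ _*_ -_ 0# public
  open import Algebra.Properties.Group +-group using (ε⁻¹≈ε)
  open import Algebra.Properties.CommutativeSemigroup +-commutativeSemigroup
    using (interchange; x∙yz≈y∙xz)
  open import Relation.Binary.Reasoning.Setoid setoid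

  Poly : Set
  Poly = List A

  scale : A → Poly → Poly
  scale a = map (a *_)

  coeff : Poly → ℕ → A
  coeff []      _       = 0#
  coeff (a ∷ p) zero    = a
  coeff (a ∷ p) (suc i) = coeff p i

  infix 4 _≈ₚ_
  record _≈ₚ_ (p q : Poly) : Set ℓ where
    constructor coeffwise
    field at : ∀ i → coeff p i ≈ coeff q i
  open _≈ₚ_ public

  ≈ₚ-refl : ∀ {p} → p ≈ₚ p
  ≈ₚ-refl = coeffwise λ _ → refl

  ≈ₚ-sym : ∀ {p q} → p ≈ₚ q → q ≈ₚ p
  ≈ₚ-sym e = coeffwise λ i → sym (at e i)

  ≈ₚ-trans : ∀ {p q r} → p ≈ₚ q → q ≈ₚ r → p ≈ₚ r
  ≈ₚ-trans e f = coeffwise λ i → trans (at e i) (at f i)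

  ∷-cong : ∀ {a b p q} → a ≈ b → p ≈ₚ q → (a ∷ p) ≈ₚ (b ∷ q)
  ∷-cong e e′ = coeffwise λ { zero → e ; (suc i) → at e′ i }

  ∷≈ₚ[] : ∀ {a p} → a ≈ 0# → p ≈ₚ [] → (a ∷ p) ≈ₚ []
  ∷≈ₚ[] e e′ = coeffwise λ { zero → e ; (suc i) → at e′ i }

  tail : Poly → Poly
  tail []      = []
  tail (a ∷ p) = p

  coeff-tail : ∀ p i → coeff (tail p) i ≈ coeff p (suc i)
  coeff-tail []      i = refl
  coeff-tail (a ∷ p) i = refl

  tail-cong : ∀ {p q} → p ≈ₚ q → tail p ≈ₚ tail q
  tail-cong {p} {q} e = coeffwise λ i → trans (coeff-tail p i) (trans (at e (suc i)) (sym (coeff-tail q i)))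

  coeff-⊕ : ∀ p q i → coeff (p ⊕ q) i ≈ coeff p i + coeff q i
  coeff-⊕ []      q       i       = sym (+-identityˡ _)
  coeff-⊕ (a ∷ p) []      i       = sym (+-identityʳ _)
  coeff-⊕ (a ∷ p) (b ∷ q) zero    = refl
  coeff-⊕ (a ∷ p) (b ∷ q) (suc i) = coeff-⊕ p q i

  coeff-neg : ∀ p i → coeff (neg p) i ≈ - coeff p i
  coeff-neg []      i       = sym ε⁻¹≈ε
  coeff-neg (a ∷ p) zero    = refl
  coeff-neg (a ∷ p) (suc i) = coeff-neg p i

  coeff-scale : ∀ a p i → coeff (scale a p) i ≈ a * coeff p i
  coeff-scale a []      i       = sym (zeroʳ a)
  coeff-scale a (b ∷ p) zero    = refl
  coeff-scale a (b ∷ p) (suc i) = coeff-scale a p i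

  coeffwise-+ : ∀ {r} p q → (∀ i → coeff r i ≈ coeff p i + coeff q i) → r ≈ₚ (p ⊕ q)
  coeffwise-+ p q e = coeffwise λ i → trans (e i) (sym (coeff-⊕ p q i))

  ⊕-cong : ∀ {p p′ q q′} → p ≈ₚ p′ → q ≈ₚ q′ → (p ⊕ q) ≈ₚ (p′ ⊕ q′)
  ⊕-cong {p} {p′} {q} {q′} e f = coeffwise λ i →
    trans (coeff-⊕ p q i) (trans (+-cong (at e i) (at f i)) (sym (coeff-⊕ p′ q′ i)))

  neg-cong : ∀ {p q} → p ≈ₚ q → neg p ≈ₚ neg q
  neg-cong {p} {q} e = coeffwise λ i →
    trans (coeff-neg p i) (trans (-‿cong (at e i)) (sym (coeff-neg q i)))

  scale-cong : ∀ {a b p q} → a ≈ b → p ≈ₚ q → scale a p ≈ₚ scale b q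
  scale-cong {a} {b} {p} {q} e f = coeffwise λ i →
    trans (coeff-scale a p i) (trans (*-cong e (at f i)) (sym (coeff-scale b q i)))

  ⊕-comm : ∀ p q → (p ⊕ q) ≈ₚ (q ⊕ p)
  ⊕-comm p q = coeffwise-+ q p λ i → trans (coeff-⊕ p q i) (+-comm _ _)

  ⊕-assoc : ∀ p q r → ((p ⊕ q) ⊕ r) ≈ₚ (p ⊕ (q ⊕ r))
  ⊕-assoc p q r = coeffwise-+ p (q ⊕ r) λ i → begin
    coeff ((p ⊕ q) ⊕ r) i             ≈⟨ coeff-⊕ (p ⊕ q) r i ⟩
    coeff (p ⊕ q) i + coeff r i       ≈⟨ +-congʳ (coeff-⊕ p q i) ⟩
    (coeff p i + coeff q i) + coeff r i ≈⟨ +-assoc _ _ _ ⟩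
    coeff p i + (coeff q i + coeff r i) ≈⟨ +-congˡ (coeff-⊕ q r i) ⟨
    coeff p i + coeff (q ⊕ r) i       ∎

  ⊕-identityʳ : ∀ p → (p ⊕ []) ≈ₚ p
  ⊕-identityʳ p = coeffwise λ i → trans (coeff-⊕ p [] i) (+-identityʳ _)

  ⊕-inverseʳ : ∀ p → (p ⊕ neg p) ≈ₚ []
  ⊕-inverseʳ p = coeffwise λ i →
    trans (coeff-⊕ p (neg p) i) (trans (+-congˡ (coeff-neg p i)) (-‿inverseʳ _))

  ⊕-inverseˡ : ∀ p → (neg p ⊕ p) ≈ₚ []
  ⊕-inverseˡ p = ≈ₚ-trans (⊕-comm (neg p) p) (⊕-inverseʳ p)

  ⊕-interchange : ∀ p q r s → ((p ⊕ q) ⊕ (r ⊕ s)) ≈ₚ ((p ⊕ r) ⊕ (q ⊕ s))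
  ⊕-interchange p q r s = coeffwise λ i → begin
    coeff ((p ⊕ q) ⊕ (r ⊕ s)) i                           ≈⟨ coeff-⊕ (p ⊕ q) (r ⊕ s) i ⟩
    coeff (p ⊕ q) i + coeff (r ⊕ s) i                     ≈⟨ +-cong (coeff-⊕ p q i) (coeff-⊕ r s i) ⟩
    (coeff p i + coeff q i) + (coeff r i + coeff s i)     ≈⟨ interchange _ _ _ _ ⟩
    (coeff p i + coeff r i) + (coeff q i + coeff s i)     ≈⟨ +-cong (coeff-⊕ p r i) (coeff-⊕ q s i) ⟨
    coeff (p ⊕ r) i + coeff (q ⊕ s) i                     ≈⟨ coeff-⊕ (p ⊕ r) (q ⊕ s) i ⟨
    coeff ((p ⊕ r) ⊕ (q ⊕ s)) i                           ∎

  ⊕-leftcomm : ∀ p q r → (p ⊕ (q ⊕ r)) ≈ₚ (q ⊕ (p ⊕ r))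
  ⊕-leftcomm p q r = coeffwise λ i → begin
    coeff (p ⊕ (q ⊕ r)) i             ≈⟨ coeff-⊕ p (q ⊕ r) i ⟩
    coeff p i + coeff (q ⊕ r) i       ≈⟨ +-congˡ (coeff-⊕ q r i) ⟩
    coeff p i + (coeff q i + coeff r i) ≈⟨ x∙yz≈y∙xz _ _ _ ⟩
    coeff q i + (coeff p i + coeff r i) ≈⟨ +-congˡ (coeff-⊕ p r i) ⟨
    coeff q i + coeff (p ⊕ r) i       ≈⟨ coeff-⊕ q (p ⊕ r) i ⟨
    coeff (q ⊕ (p ⊕ r)) i             ∎

  scale-zero : ∀ {a} p → a ≈ 0# → scale a p ≈ₚ []
  scale-zero {a} p e = coeffwise λ i → trans (coeff-scale a p i) (trans (*-congʳ e) (zeroˡ _))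

  scale-+ : ∀ a b p → scale (a + b) p ≈ₚ (scale a p ⊕ scale b p)
  scale-+ a b p = coeffwise-+ (scale a p) (scale b p) λ i → begin
    coeff (scale (a + b) p) i                 ≈⟨ coeff-scale (a + b) p i ⟩
    (a + b) * coeff p i                       ≈⟨ distribʳ _ _ _ ⟩
    a * coeff p i + b * coeff p i             ≈⟨ +-cong (coeff-scale a p i) (coeff-scale b p i) ⟨
    coeff (scale a p) i + coeff (scale b p) i ∎

  scale-⊕ : ∀ a p q → scale a (p ⊕ q) ≈ₚ (scale a p ⊕ scale a q)
  scale-⊕ a p q = coeffwise-+ (scale a p) (scale a q) λ i → begin
    coeff (scale a (p ⊕ q)) i                 ≈⟨ coeff-scale a (p ⊕ q) i ⟩
    a * coeff (p ⊕ q) i                       ≈⟨ *-congˡ (coeff-⊕ p q i) ⟩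
    a * (coeff p i + coeff q i)               ≈⟨ distribˡ _ _ _ ⟩
    a * coeff p i + a * coeff q i             ≈⟨ +-cong (coeff-scale a p i) (coeff-scale a q i) ⟨
    coeff (scale a p) i + coeff (scale a q) i ∎

  scale-* : ∀ a b p → scale (a * b) p ≈ₚ scale a (scale b p)
  scale-* a b p = coeffwise λ i → begin
    coeff (scale (a * b) p) i        ≈⟨ coeff-scale (a * b) p i ⟩
    (a * b) * coeff p i              ≈⟨ *-assoc _ _ _ ⟩
    a * (b * coeff p i)              ≈⟨ *-congˡ (coeff-scale b p i) ⟨
    a * coeff (scale b p) i          ≈⟨ coeff-scale a (scale b p) i ⟨
    coeff (scale a (scale b p)) i    ∎

  scale-1 : ∀ p → scale 1# p ≈ₚ p
  scale-1 p = coeffwise λ i → trans (coeff-scale 1# p i) (*-identityˡ _)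

  0∷[]≈ₚ[] : (0# ∷ []) ≈ₚ []
  0∷[]≈ₚ[] = ∷≈ₚ[] refl ≈ₚ-refl

  ⊗-zeroʳ : ∀ p → (p ⊗ []) ≈ₚ []
  ⊗-zeroʳ []      = ≈ₚ-refl
  ⊗-zeroʳ (a ∷ p) = ∷≈ₚ[] refl (⊗-zeroʳ p)

  0∷-⊗ : ∀ p q → ((0# ∷ p) ⊗ q) ≈ₚ (0# ∷ (p ⊗ q))
  0∷-⊗ p q = ⊕-cong (scale-zero q refl) ≈ₚ-refl

  ⊗-congˡ : ∀ {p p′} q → p ≈ₚ p′ → (p ⊗ q) ≈ₚ (p′ ⊗ q)
  ⊗-congˡ {[]}    {[]}     q e = ≈ₚ-refl
  ⊗-congˡ {[]}    {b ∷ p′} q e = ≈ₚ-sym (≈ₚ-trans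
    (⊕-cong (scale-zero q (sym (at e zero))) (∷-cong refl (≈ₚ-sym (⊗-congˡ {[]} {p′} q (tail-cong e)))))
    0∷[]≈ₚ[])
  ⊗-congˡ {a ∷ p} {[]}     q e = ≈ₚ-trans
    (⊕-cong (scale-zero q (at e zero)) (∷-cong refl (⊗-congˡ {p} {[]} q (tail-cong e))))
    0∷[]≈ₚ[]
  ⊗-congˡ {a ∷ p} {b ∷ p′} q e = ⊕-cong (scale-cong (at e zero) ≈ₚ-refl) (∷-cong refl (⊗-congˡ {p} {p′} q (tail-cong e)))

  ⊗-congʳ : ∀ p {q q′} → q ≈ₚ q′ → (p ⊗ q) ≈ₚ (p ⊗ q′)
  ⊗-congʳ []      e = ≈ₚ-refl
  ⊗-congʳ (a ∷ p) e = ⊕-cong (scale-cong refl e) (∷-cong refl (⊗-congʳ p e))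

  ⊗-cong : ∀ {p p′ q q′} → p ≈ₚ p′ → q ≈ₚ q′ → (p ⊗ q) ≈ₚ (p′ ⊗ q′)
  ⊗-cong {p′ = p′} {q = q} e f = ≈ₚ-trans (⊗-congˡ q e) (⊗-congʳ p′ f)

  ⊗-distribʳ : ∀ p p′ q → ((p ⊕ p′) ⊗ q) ≈ₚ ((p ⊗ q) ⊕ (p′ ⊗ q))
  ⊗-distribʳ []      p′       q = ≈ₚ-refl
  ⊗-distribʳ (a ∷ p) []       q = ≈ₚ-sym (⊕-identityʳ _)
  ⊗-distribʳ (a ∷ p) (b ∷ p′) q = ≈ₚ-trans
    (⊕-cong (scale-+ a b q) (∷-cong (sym (+-identityʳ 0#)) (⊗-distribʳ p p′ q)))
    (⊕-interchange (scale a q) (scale b q) (0# ∷ (p ⊗ q)) (0# ∷ (p′ ⊗ q)))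

  scale-⊗ : ∀ a p q → (scale a p ⊗ q) ≈ₚ scale a (p ⊗ q)
  scale-⊗ a []      q = ≈ₚ-refl
  scale-⊗ a (b ∷ p) q = ≈ₚ-sym (≈ₚ-trans (scale-⊕ a (scale b q) (0# ∷ (p ⊗ q)))
    (⊕-cong (≈ₚ-sym (scale-* a b q)) (∷-cong (zeroʳ a) (≈ₚ-sym (scale-⊗ a p q)))))

  ⊗-assoc : ∀ p q r → ((p ⊗ q) ⊗ r) ≈ₚ (p ⊗ (q ⊗ r))
  ⊗-assoc []      q r = ≈ₚ-refl
  ⊗-assoc (a ∷ p) q r = ≈ₚ-trans (⊗-distribʳ (scale a q) (0# ∷ (p ⊗ q)) r)
    (⊕-cong (scale-⊗ a q r) (≈ₚ-trans (0∷-⊗ (p ⊗ q) r) (∷-cong refl (⊗-assoc p q r))))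

  ⊗-∷ʳ : ∀ p b q → (p ⊗ (b ∷ q)) ≈ₚ (scale b p ⊕ (0# ∷ (p ⊗ q)))
  ⊗-∷ʳ []      b q = ≈ₚ-sym 0∷[]≈ₚ[]
  ⊗-∷ʳ (a ∷ p) b q = ∷-cong (+-cong (*-comm a b) refl)
    (≈ₚ-trans (⊕-cong (≈ₚ-refl {scale a q}) (⊗-∷ʳ p b q)) (⊕-leftcomm (scale a q) (scale b p) (0# ∷ (p ⊗ q))))

  ⊗-comm : ∀ p q → (p ⊗ q) ≈ₚ (q ⊗ p)
  ⊗-comm []      q = ≈ₚ-sym (⊗-zeroʳ q)
  ⊗-comm (a ∷ p) q = ≈ₚ-trans (⊕-cong (≈ₚ-refl {scale a q}) (∷-cong refl (⊗-comm p q))) (≈ₚ-sym (⊗-∷ʳ q a p))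

  ⊗-identityˡ : ∀ p → ((1# ∷ []) ⊗ p) ≈ₚ p
  ⊗-identityˡ p = ≈ₚ-trans (⊕-cong (scale-1 p) 0∷[]≈ₚ[]) (⊕-identityʳ p)

  ⊗-identityʳ : ∀ p → (p ⊗ (1# ∷ [])) ≈ₚ p
  ⊗-identityʳ p = ≈ₚ-trans (⊗-comm p _) (⊗-identityˡ p)

  ⊗-distribˡ : ∀ p q q′ → (p ⊗ (q ⊕ q′)) ≈ₚ ((p ⊗ q) ⊕ (p ⊗ q′))
  ⊗-distribˡ p q q′ = ≈ₚ-trans (⊗-comm p (q ⊕ q′))
    (≈ₚ-trans (⊗-distribʳ q q′ p) (⊕-cong (⊗-comm q p) (⊗-comm q′ p)))

  ⊗-0∷ : ∀ p q → (p ⊗ (0# ∷ q)) ≈ₚ (0# ∷ (p ⊗ q))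
  ⊗-0∷ p q = ≈ₚ-trans (⊗-∷ʳ p 0# q) (⊕-cong (scale-zero p refl) ≈ₚ-refl)

  polynomialRing : CommutativeRing 0ℓ ℓ
  polynomialRing = record
    { Carrier = Poly ; _≈_ = _≈ₚ_ ; _+_ = _⊕_ ; _*_ = _⊗_ ; -_ = neg ; 0# = [] ; 1# = 1# ∷ []
    ; isCommutativeRing = record
      { isRing = record
        { +-isAbelianGroup = record
          { isGroup = record
            { isMonoid = record
              { isSemigroup = record
                { isMagma = record
                  { isEquivalence = record { refl = ≈ₚ-refl ; sym = ≈ₚ-sym ; trans = ≈ₚ-trans }
                  ; ∙-cong = ⊕-cong }
                ; assoc = ⊕-assoc }
              ; identity = (λ _ → ≈ₚ-refl) , ⊕-identityʳ }
            ; inverse = ⊕-inverseˡ , ⊕-inverseʳ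
            ; ⁻¹-cong = neg-cong }
          ; comm = ⊕-comm }
        ; *-cong = ⊗-cong
        ; *-assoc = ⊗-assoc
        ; *-identity = ⊗-identityˡ , ⊗-identityʳ
        ; distrib = ⊗-distribˡ , (λ x y z → ⊗-distribʳ y z x) }
      ; *-comm = ⊗-comm } }

  All⇒≈ₚ[] : ∀ {p} {Z : A → Set p} → (∀ {x} → Z x → x ≈ 0#) → ∀ {q} → All Z q → q ≈ₚ []
  All⇒≈ₚ[] z⇒0 []       = ≈ₚ-refl
  All⇒≈ₚ[] z⇒0 (z ∷ zs) = ∷≈ₚ[] (z⇒0 z) (All⇒≈ₚ[] z⇒0 zs)

  ≈ₚ[]⇒All : ∀ {p} {Z : A → Set p} → (∀ {x} → x ≈ 0# → Z x) → ∀ q → q ≈ₚ [] → All Z q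
  ≈ₚ[]⇒All 0⇒z []      e = []
  ≈ₚ[]⇒All 0⇒z (a ∷ q) e = 0⇒z (at e zero) ∷ ≈ₚ[]⇒All 0⇒z q (tail-cong e)

  coeff-const⊗ : ∀ a q i → coeff ((a ∷ []) ⊗ q) i ≈ a * coeff q i
  coeff-const⊗ a q i = begin
    coeff (scale a q ⊕ (0# ∷ [])) i       ≈⟨ coeff-⊕ (scale a q) (0# ∷ []) i ⟩
    coeff (scale a q) i + coeff (0# ∷ []) i ≈⟨ +-congˡ (at 0∷[]≈ₚ[] i) ⟩
    coeff (scale a q) i + 0#              ≈⟨ +-identityʳ _ ⟩
    coeff (scale a q) i                   ≈⟨ coeff-scale a q i ⟩
    a * coeff q i                         ∎

  module NoZeroDivisors (0≟_ : ∀ x → Dec (x ≈ 0#))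
                        (zero-product : ∀ x y → x * y ≈ 0# → x ≈ 0# ⊎ y ≈ 0#) where

    ≈ₚ[]? : ∀ p → Dec (p ≈ₚ [])
    ≈ₚ[]? []      = yes ≈ₚ-refl
    ≈ₚ[]? (a ∷ p) with 0≟ a | ≈ₚ[]? p
    ... | yes a≈0 | yes p≈0 = yes (∷≈ₚ[] a≈0 p≈0)
    ... | no  a≉0 | _       = no λ e → a≉0 (at e zero)
    ... | yes _   | no  p≉0 = no λ e → p≉0 (tail-cong e)

    ⊗-zero-product : ∀ p q → (p ⊗ q) ≈ₚ [] → p ≈ₚ [] ⊎ q ≈ₚ []
    ⊗-zero-product []      q e = inj₁ ≈ₚ-refl
    ⊗-zero-product (a ∷ p) q e with 0≟ a
    ... | yes a≈0 with ⊗-zero-product p q (tail-cong (≈ₚ-trans (≈ₚ-sym (0∷-⊗ p q))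
                                            (≈ₚ-trans (⊗-congˡ q (∷-cong (sym a≈0) (≈ₚ-refl {p}))) e)))
    ...   | inj₁ p≈0 = inj₁ (∷≈ₚ[] a≈0 p≈0)
    ...   | inj₂ q≈0 = inj₂ q≈0
    ⊗-zero-product (a ∷ p) q e | no a≉0 = inj₂ (right-factor q e)
      where
      right-factor : ∀ q → ((a ∷ p) ⊗ q) ≈ₚ [] → q ≈ₚ []
      right-factor []      _  = ≈ₚ-refl
      right-factor (b ∷ q) e′ with zero-product a b (trans (sym (+-identityʳ _)) (at e′ zero))
      ... | inj₁ a≈0 = ⊥-elim (a≉0 a≈0)
      ... | inj₂ b≈0 = ∷≈ₚ[] b≈0 (right-factor q (tail-cong
            (≈ₚ-trans (≈ₚ-sym (≈ₚ-trans (⊗-congʳ (a ∷ p) (∷-cong b≈0 ≈ₚ-refl)) (⊗-0∷ (a ∷ p) q))) e′)))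

  AllCoeffs : ∀ {p} → (A → Set p) → Poly → Set p
  AllCoeffs Q p = ∀ i → Q (coeff p i)

  module _ {p} {Q : A → Set p} (resp : ∀ {x y} → x ≈ y → Q y → Q x) where

    AllCoeffs-⊕ : (∀ {x y} → Q x → Q y → Q (x + y)) → ∀ f g → AllCoeffs Q f → AllCoeffs Q g → AllCoeffs Q (f ⊕ g)
    AllCoeffs-⊕ q+ f g qf qg i = resp (coeff-⊕ f g i) (q+ (qf i) (qg i))

    AllCoeffs-neg : (∀ {x} → Q x → Q (- x)) → ∀ f → AllCoeffs Q f → AllCoeffs Q (neg f)
    AllCoeffs-neg q- f qf i = resp (coeff-neg f i) (q- (qf i))

  AllCoeffs-All : ∀ {p} {Q : A → Set p} → Q 0# → ∀ {f} → All Q f → AllCoeffs Q f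
  AllCoeffs-All q0 []       i       = q0
  AllCoeffs-All q0 (q ∷ qs) zero    = q
  AllCoeffs-All q0 (q ∷ qs) (suc i) = AllCoeffs-All q0 qs i

  AllCoeffs-⊗ : ∀ {p q s} {P : A → Set p} {Q : A → Set q} {S : A → Set s} →
    (∀ {x y} → x ≈ y → S y → S x) → S 0# → (∀ {x y} → S x → S y → S (x + y)) →
    (∀ {x y} → P x → Q y → S (x * y)) →
    ∀ f g → AllCoeffs P f → AllCoeffs Q g → AllCoeffs S (f ⊗ g)
  AllCoeffs-⊗ resp s0 s+ s* []      g pf qg i = s0
  AllCoeffs-⊗ {S = S} resp s0 s+ s* (x ∷ f) g pf qg i =
    resp (coeff-⊕ (scale x g) (0# ∷ (f ⊗ g)) i)
         (s+ (resp (coeff-scale x g i) (s* (pf zero) (qg i))) (shifted i))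
    where
    shifted : ∀ i → S (coeff (0# ∷ (f ⊗ g)) i)
    shifted zero    = s0
    shifted (suc i) = AllCoeffs-⊗ resp s0 s+ s* f g (λ j → pf (suc j)) qg i

  record DegreeAtMost (D : ℕ) (p : Poly) : Set ℓ where
    constructor degree≤
    field vanishes : ∀ i → D ℕ.< i → coeff p i ≈ 0#
  open DegreeAtMost public

  degree-resp : ∀ {D p q} → p ≈ₚ q → DegreeAtMost D q → DegreeAtMost D p
  degree-resp e d = degree≤ λ i lt → trans (at e i) (vanishes d i lt)

  degree-mono : ∀ {D D′ p} → D ℕ.≤ D′ → DegreeAtMost D p → DegreeAtMost D′ p
  degree-mono le d = degree≤ λ i lt → vanishes d i (ℕₚ.≤-<-trans le lt)

  degree-[] : ∀ {D} → DegreeAtMost D []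
  degree-[] = degree≤ λ _ _ → refl

  degree-⊕ : ∀ {D p q} → DegreeAtMost D p → DegreeAtMost D q → DegreeAtMost D (p ⊕ q)
  degree-⊕ {p = p} {q} d d′ = degree≤ λ i lt →
    trans (coeff-⊕ p q i) (trans (+-cong (vanishes d i lt) (vanishes d′ i lt)) (+-identityˡ 0#))

  degree-neg : ∀ {D p} → DegreeAtMost D p → DegreeAtMost D (neg p)
  degree-neg {p = p} d = degree≤ λ i lt → trans (coeff-neg p i) (trans (-‿cong (vanishes d i lt)) ε⁻¹≈ε)

  degree-scale : ∀ {D} a p → DegreeAtMost D p → DegreeAtMost D (scale a p)
  degree-scale a p d = degree≤ λ i lt → trans (coeff-scale a p i) (trans (*-congˡ (vanishes d i lt)) (zeroʳ a))

  degree-⊗ : ∀ {D E} p q → DegreeAtMost D p → DegreeAtMost E q → DegreeAtMost (D ℕ.+ E) (p ⊗ q)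
  degree-⊗         []      q dp dq = degree≤ λ _ _ → refl
  degree-⊗ {D} {E} (x ∷ p) q dp dq =
    degree-⊕ (degree-mono (ℕₚ.m≤n+m E D) (degree-scale x q dq)) (degree≤ (shifted D dp))
    where
    shifted : ∀ D → DegreeAtMost D (x ∷ p) → ∀ i → D ℕ.+ E ℕ.< i → coeff (0# ∷ (p ⊗ q)) i ≈ 0#
    shifted D       dp zero    ()
    shifted zero    dp (suc i) lt = at (⊗-congˡ {p} {[]} q (coeffwise λ j → vanishes dp (suc j) (s≤s z≤n))) i
    shifted (suc D) dp (suc i) lt =
      vanishes (degree-⊗ p q (degree≤ λ j lt′ → vanishes dp (suc j) (s≤s lt′)) dq) i (ℕₚ.≤-pred lt)

  degree-const : ∀ a → DegreeAtMost 0 (a ∷ [])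
  degree-const a = degree≤ λ { (suc i) _ → refl }

  degree-length : ∀ p → DegreeAtMost (length p) p
  degree-length p = degree≤ (beyond p)
    where
    beyond : ∀ p i → length p ℕ.< i → coeff p i ≈ 0#
    beyond []      i       _  = refl
    beyond (a ∷ p) (suc i) lt = beyond p i (ℕₚ.≤-pred lt)

  X : Poly
  X = 0# ∷ 1# ∷ []

  coeff-X⊗ : ∀ p i → coeff (X ⊗ p) (suc i) ≈ coeff p i
  coeff-X⊗ p i = at (≈ₚ-trans (0∷-⊗ (1# ∷ []) p) (∷-cong refl (⊗-identityˡ p))) (suc i)

  X-orbit-bounded⇒zero : ∀ {D} (r : ℕ → Poly) → (∀ k → r (suc k) ≈ₚ X ⊗ r k) →
                         (∀ k → DegreeAtMost D (r k)) → r 0 ≈ₚ []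
  X-orbit-bounded⇒zero {D} r step bounded = coeffwise λ i →
    trans (sym (coeff-orbit (suc D) i)) (vanishes (bounded (suc D)) (suc D ℕ.+ i) (s≤s (ℕₚ.m≤m+n D i)))
    where
    coeff-orbit : ∀ k i → coeff (r k) (k ℕ.+ i) ≈ coeff (r 0) i
    coeff-orbit zero    i = refl
    coeff-orbit (suc k) i = trans (at (step k) (suc (k ℕ.+ i))) (trans (coeff-X⊗ (r k) (k ℕ.+ i)) (coeff-orbit k i))

foldr-tabulate : ∀ {A B : Set} {m n} (_⊕_ : A → B → B) (z : B) (f : Fin n → A) (g : Fin m → Fin n) →
  List.foldr (λ i acc → f i ⊕ acc) z (tabulate g) ≡ Vector.foldr _⊕_ z (f ∘ g)
foldr-tabulate {m = zero}  _⊕_ z f g = ≡.refl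
foldr-tabulate {m = suc m} _⊕_ z f g = ≡.cong (f (g zero) ⊕_) (foldr-tabulate _⊕_ z f (g ∘ suc))

Σᶠ≡foldr : ∀ {A : Set} {n} (z : A) (_⊕_ : A → A → A) (f : Fin n → A) → Σᶠ z _⊕_ f ≡ Vector.foldr _⊕_ z f
Σᶠ≡foldr z _⊕_ f = foldr-tabulate _⊕_ z f (λ i → i)

module SelectingSums {c ℓ} (M : CommutativeMonoid c ℓ) where
  open CommutativeMonoid M
  open import Algebra.Properties.CommutativeMonoid.Sum M using (sum; sum-replicate-zero)

  sum-selectˡ : ∀ {n} (f : Fin n → Carrier) w → sum (λ v → if eqᵇ v w then f v else ε) ≈ f w
  sum-selectˡ {suc n} f zero    = trans (∙-congˡ (sum-replicate-zero n)) (identityʳ _)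
  sum-selectˡ {suc n} f (suc w) = trans (identityˡ _) (sum-selectˡ (f ∘ suc) w)

  sum-selectʳ : ∀ {n} (f : Fin n → Carrier) w → sum (λ v → if eqᵇ w v then f v else ε) ≈ f w
  sum-selectʳ {suc n} f zero    = trans (∙-congˡ (sum-replicate-zero n)) (identityʳ _)
  sum-selectʳ {suc n} f (suc w) = trans (identityˡ _) (sum-selectʳ (f ∘ suc) w)

module Matrices {c ℓ} (R : CommutativeRing c ℓ) where
  open CommutativeRing R
  open import Algebra.Properties.Semiring.Sum semiring public
    using (sum; sum-cong-≋; ∑-distrib-+; ∑-comm; *-distribˡ-sum; *-distribʳ-sum)
  open import Algebra.Properties.Ring ring using (-1*x≈-x; -‿distribˡ-*; -‿distribʳ-*)
  open SelectingSums +-commutativeMonoid public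
  open import Relation.Binary.Reasoning.Setoid setoid

  neg-sum : ∀ {n} (f : Fin n → Carrier) → - sum f ≈ sum (λ i → - f i)
  neg-sum f = trans (sym (-1*x≈-x _)) (trans (*-distribˡ-sum (- 1#) f) (sum-cong-≋ λ i → -1*x≈-x (f i)))

  Matrix : ℕ → Set c
  Matrix n = Fin n → Fin n → Carrier

  infix  4 _≋_
  infixl 7 _*ᴹ_ _·ᴹ_
  infixl 6 _-ᴹ_

  _≋_ : ∀ {n} → Matrix n → Matrix n → Set ℓ
  X ≋ Y = ∀ u w → X u w ≈ Y u w

  _*ᴹ_ : ∀ {n} → Matrix n → Matrix n → Matrix n
  (X *ᴹ Y) u w = sum (λ v → X u v * Y v w)

  _-ᴹ_ : ∀ {n} → Matrix n → Matrix n → Matrix n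
  (X -ᴹ Y) u v = X u v - Y u v

  _·ᴹ_ : ∀ {n} → Carrier → Matrix n → Matrix n
  (a ·ᴹ X) u v = a * X u v

  1ᴹ : ∀ {n} → Matrix n
  1ᴹ u v = if eqᵇ u v then 1# else 0#

  infixr 8 _^ᴹ_
  _^ᴹ_ : ∀ {n} → Matrix n → ℕ → Matrix n
  X ^ᴹ zero  = 1ᴹ
  X ^ᴹ suc k = X *ᴹ X ^ᴹ k

  ≋-refl : ∀ {n} {X : Matrix n} → X ≋ X
  ≋-refl u w = refl

  ≋-sym : ∀ {n} {X Y : Matrix n} → X ≋ Y → Y ≋ X
  ≋-sym e u v = sym (e u v)

  ≋-trans : ∀ {n} {X Y Z : Matrix n} → X ≋ Y → Y ≋ Z → X ≋ Z
  ≋-trans e f u v = trans (e u v) (f u v)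

  *ᴹ-cong : ∀ {n} {X X′ Y Y′ : Matrix n} → X ≋ X′ → Y ≋ Y′ → X *ᴹ Y ≋ X′ *ᴹ Y′
  *ᴹ-cong e f u w = sum-cong-≋ λ v → *-cong (e u v) (f v w)

  -ᴹ-cong : ∀ {n} {X X′ Y Y′ : Matrix n} → X ≋ X′ → Y ≋ Y′ → X -ᴹ Y ≋ X′ -ᴹ Y′
  -ᴹ-cong e f u v = +-cong (e u v) (-‿cong (f u v))

  ·ᴹ-congˡ : ∀ {n} a {X X′ : Matrix n} → X ≋ X′ → a ·ᴹ X ≋ a ·ᴹ X′
  ·ᴹ-congˡ a e u v = *-congˡ (e u v)

  *ᴹ-assoc : ∀ {n} (X Y Z : Matrix n) → (X *ᴹ Y) *ᴹ Z ≋ X *ᴹ (Y *ᴹ Z)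
  *ᴹ-assoc X Y Z u w = begin
    sum (λ v → sum (λ x → X u x * Y x v) * Z v w)     ≈⟨ sum-cong-≋ (λ v → *-distribʳ-sum (Z v w) (λ x → X u x * Y x v)) ⟩
    sum (λ v → sum (λ x → (X u x * Y x v) * Z v w))   ≈⟨ ∑-comm (λ v x → (X u x * Y x v) * Z v w) ⟩
    sum (λ x → sum (λ v → (X u x * Y x v) * Z v w))   ≈⟨ sum-cong-≋ (λ x → sum-cong-≋ λ v → *-assoc (X u x) (Y x v) (Z v w)) ⟩
    sum (λ x → sum (λ v → X u x * (Y x v * Z v w)))   ≈⟨ sum-cong-≋ (λ x → *-distribˡ-sum (X u x) (λ v → Y x v * Z v w)) ⟨
    sum (λ x → X u x * sum (λ v → Y x v * Z v w))     ∎

  *ᴹ-identityˡ : ∀ {n} (X : Matrix n) → 1ᴹ *ᴹ X ≋ X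
  *ᴹ-identityˡ X u w = trans (sum-cong-≋ λ v → unit* (eqᵇ u v) (X v w)) (sum-selectʳ (λ v → X v w) u)
    where
    unit* : ∀ b x → (if b then 1# else 0#) * x ≈ (if b then x else 0#)
    unit* true  x = *-identityˡ x
    unit* false x = zeroˡ x

  *ᴹ-identityʳ : ∀ {n} (X : Matrix n) → X *ᴹ 1ᴹ ≋ X
  *ᴹ-identityʳ X u w = trans (sum-cong-≋ λ v → *unit (eqᵇ v w) (X u v)) (sum-selectˡ (λ v → X u v) w)
    where
    *unit : ∀ b x → x * (if b then 1# else 0#) ≈ (if b then x else 0#)
    *unit true  x = *-identityʳ x
    *unit false x = zeroʳ x

  ^ᴹ-suc-comm : ∀ {n} (X : Matrix n) k → X ^ᴹ k *ᴹ X ≋ X ^ᴹ suc k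
  ^ᴹ-suc-comm X zero    = ≋-trans (*ᴹ-identityˡ X) (≋-sym (*ᴹ-identityʳ X))
  ^ᴹ-suc-comm X (suc k) = ≋-trans (*ᴹ-assoc X (X ^ᴹ k) X) (*ᴹ-cong (≋-refl {X = X}) (^ᴹ-suc-comm X k))

  *ᴹ-distribʳ--ᴹ : ∀ {n} (X Y Z : Matrix n) → (Y -ᴹ Z) *ᴹ X ≋ Y *ᴹ X -ᴹ Z *ᴹ X
  *ᴹ-distribʳ--ᴹ X Y Z u w = begin
    sum (λ v → (Y u v - Z u v) * X v w)
      ≈⟨ sum-cong-≋ (λ v → trans (distribʳ (X v w) (Y u v) (- Z u v)) (+-congˡ (sym (-‿distribˡ-* (Z u v) (X v w))))) ⟩
    sum (λ v → Y u v * X v w + - (Z u v * X v w))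
      ≈⟨ ∑-distrib-+ (λ v → Y u v * X v w) (λ v → - (Z u v * X v w)) ⟩
    (Y *ᴹ X) u w + sum (λ v → - (Z u v * X v w))
      ≈⟨ +-congˡ (neg-sum (λ v → Z u v * X v w)) ⟨
    (Y *ᴹ X) u w - (Z *ᴹ X) u w ∎

  *ᴹ-distribˡ--ᴹ : ∀ {n} (X Y Z : Matrix n) → X *ᴹ (Y -ᴹ Z) ≋ X *ᴹ Y -ᴹ X *ᴹ Z
  *ᴹ-distribˡ--ᴹ X Y Z u w = begin
    sum (λ v → X u v * (Y v w - Z v w))
      ≈⟨ sum-cong-≋ (λ v → trans (distribˡ (X u v) (Y v w) (- Z v w)) (+-congˡ (sym (-‿distribʳ-* (X u v) (Z v w))))) ⟩
    sum (λ v → X u v * Y v w + - (X u v * Z v w))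
      ≈⟨ ∑-distrib-+ (λ v → X u v * Y v w) (λ v → - (X u v * Z v w)) ⟩
    (X *ᴹ Y) u w + sum (λ v → - (X u v * Z v w))
      ≈⟨ +-congˡ (neg-sum (λ v → X u v * Z v w)) ⟨
    (X *ᴹ Y) u w - (X *ᴹ Z) u w ∎

  *ᴹ-·ᴹˡ : ∀ {n} a (X Y : Matrix n) → (a ·ᴹ X) *ᴹ Y ≋ a ·ᴹ (X *ᴹ Y)
  *ᴹ-·ᴹˡ a X Y u w = trans (sum-cong-≋ λ v → *-assoc a (X u v) (Y v w)) (sym (*-distribˡ-sum a (λ v → X u v * Y v w)))

  *ᴹ-·ᴹʳ : ∀ {n} a (X Y : Matrix n) → X *ᴹ (a ·ᴹ Y) ≋ a ·ᴹ (X *ᴹ Y)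
  *ᴹ-·ᴹʳ a X Y u w =
    trans (sum-cong-≋ λ v → x∙yz≈y∙xz (X u v) a (Y v w)) (sym (*-distribˡ-sum a (λ v → X u v * Y v w)))
    where open import Algebra.Properties.CommutativeSemigroup *-commutativeSemigroup using (x∙yz≈y∙xz)

  unitSum : ∀ {m n} → (Fin m → Fin n) → (Fin m → Fin n) → (Fin m → Carrier) → Matrix n
  unitSum us vs e x y = sum (λ i → if eqᵇ x (us i) ∧ eqᵇ y (vs i) then e i else 0#)

  private
    *-if : ∀ x b y → x * (if b then y else 0#) ≈ (if b then x * y else 0#)
    *-if x true  y = refl
    *-if x false y = zeroʳ x

    if-* : ∀ x b y → (if b then y else 0#) * x ≈ (if b then y * x else 0#)
    if-* x true  y = refl
    if-* x false y = zeroˡ x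

    if-∧ : ∀ a b (y : Carrier) → (if a ∧ b then y else 0#) ≡ (if a then (if b then y else 0#) else 0#)
    if-∧ true  b y = ≡.refl
    if-∧ false b y = ≡.refl

  *ᴹ-unitSum : ∀ {m n} (us vs : Fin m → Fin n) e (X : Matrix n) u y →
               (X *ᴹ unitSum us vs e) u y ≈ sum (λ i → if eqᵇ y (vs i) then X u (us i) * e i else 0#)
  *ᴹ-unitSum us vs e X u y = begin
    sum (λ x → X u x * sum (λ i → E x i))                              ≈⟨ sum-cong-≋ (λ x → *-distribˡ-sum (X u x) (E x)) ⟩
    sum (λ x → sum (λ i → X u x * E x i))                              ≈⟨ ∑-comm (λ x i → X u x * E x i) ⟩
    sum (λ i → sum (λ x → X u x * E x i))                              ≈⟨ sum-cong-≋ (λ i → sum-cong-≋ λ x → split i x) ⟩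
    sum (λ i → sum (λ x → if eqᵇ x (us i) then X u x * F i else 0#))   ≈⟨ sum-cong-≋ (λ i → sum-selectˡ (λ x → X u x * F i) (us i)) ⟩
    sum (λ i → X u (us i) * F i)                                       ≈⟨ sum-cong-≋ (λ i → *-if (X u (us i)) (eqᵇ y (vs i)) (e i)) ⟩
    sum (λ i → if eqᵇ y (vs i) then X u (us i) * e i else 0#)          ∎
    where
    E = λ x i → if eqᵇ x (us i) ∧ eqᵇ y (vs i) then e i else 0#
    F = λ i → if eqᵇ y (vs i) then e i else 0#
    split : ∀ i x → X u x * E x i ≈ (if eqᵇ x (us i) then X u x * F i else 0#)
    split i x = trans (*-congˡ (reflexive (if-∧ (eqᵇ x (us i)) (eqᵇ y (vs i)) (e i)))) (*-if (X u x) (eqᵇ x (us i)) (F i))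

  *ᴹ-unitSum-*ᴹ : ∀ {m n} (us vs : Fin m → Fin n) e (X Y : Matrix n) u v →
                  (X *ᴹ unitSum us vs e *ᴹ Y) u v ≈ sum (λ i → X u (us i) * (e i * Y (vs i) v))
  *ᴹ-unitSum-*ᴹ us vs e X Y u v = begin
    sum (λ y → (X *ᴹ unitSum us vs e) u y * Y y v)
      ≈⟨ sum-cong-≋ (λ y → *-congʳ (*ᴹ-unitSum us vs e X u y)) ⟩
    sum (λ y → sum (λ i → G y i) * Y y v)
      ≈⟨ sum-cong-≋ (λ y → *-distribʳ-sum (Y y v) (G y)) ⟩
    sum (λ y → sum (λ i → G y i * Y y v))
      ≈⟨ ∑-comm (λ y i → G y i * Y y v) ⟩
    sum (λ i → sum (λ y → G y i * Y y v))
      ≈⟨ sum-cong-≋ (λ i → sum-cong-≋ λ y → if-* (Y y v) (eqᵇ y (vs i)) (X u (us i) * e i)) ⟩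
    sum (λ i → sum (λ y → if eqᵇ y (vs i) then (X u (us i) * e i) * Y y v else 0#))
      ≈⟨ sum-cong-≋ (λ i → sum-selectˡ (λ y → (X u (us i) * e i) * Y y v) (vs i)) ⟩
    sum (λ i → (X u (us i) * e i) * Y (vs i) v)
      ≈⟨ sum-cong-≋ (λ i → *-assoc (X u (us i)) (e i) (Y (vs i) v)) ⟩
    sum (λ i → X u (us i) * (e i * Y (vs i) v)) ∎
    where
    G = λ y i → if eqᵇ y (vs i) then X u (us i) * e i else 0#

  *ᴹ-expand : ∀ {n} d s (A P X Y : Matrix n) →
    X *ᴹ ((A -ᴹ d ·ᴹ 1ᴹ -ᴹ s ·ᴹ P) *ᴹ Y) ≋ X *ᴹ (A *ᴹ Y) -ᴹ d ·ᴹ (X *ᴹ Y) -ᴹ s ·ᴹ (X *ᴹ (P *ᴹ Y))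
  *ᴹ-expand d s A P X Y = ≋-trans (*ᴹ-cong ≋-refl expandʳ) expandˡ
    where
    expandʳ : (A -ᴹ d ·ᴹ 1ᴹ -ᴹ s ·ᴹ P) *ᴹ Y ≋ A *ᴹ Y -ᴹ d ·ᴹ Y -ᴹ s ·ᴹ (P *ᴹ Y)
    expandʳ = ≋-trans (*ᴹ-distribʳ--ᴹ Y (A -ᴹ d ·ᴹ 1ᴹ) (s ·ᴹ P))
      (-ᴹ-cong (≋-trans (*ᴹ-distribʳ--ᴹ Y A (d ·ᴹ 1ᴹ))
                        (-ᴹ-cong ≋-refl (≋-trans (*ᴹ-·ᴹˡ d 1ᴹ Y) (·ᴹ-congˡ d (*ᴹ-identityˡ Y)))))
               (*ᴹ-·ᴹˡ s P Y))
    expandˡ : X *ᴹ (A *ᴹ Y -ᴹ d ·ᴹ Y -ᴹ s ·ᴹ (P *ᴹ Y)) ≋ X *ᴹ (A *ᴹ Y) -ᴹ d ·ᴹ (X *ᴹ Y) -ᴹ s ·ᴹ (X *ᴹ (P *ᴹ Y))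
    expandˡ = ≋-trans (*ᴹ-distribˡ--ᴹ X (A *ᴹ Y -ᴹ d ·ᴹ Y) (s ·ᴹ (P *ᴹ Y)))
      (-ᴹ-cong (≋-trans (*ᴹ-distribˡ--ᴹ X (A *ᴹ Y) (d ·ᴹ Y)) (-ᴹ-cong ≋-refl (*ᴹ-·ᴹʳ d X Y)))
               (*ᴹ-·ᴹʳ s X (P *ᴹ Y)))

ℚ-zero-product : ∀ x y → x ℚ.* y ≡ 0ℚ → x ≡ 0ℚ ⊎ y ≡ 0ℚ
ℚ-zero-product x y xy≡0 with x ℚ.≟ 0ℚ
... | yes x≡0 = inj₁ x≡0
... | no  x≢0 = inj₂ (begin
    y                    ≡⟨ ℚₚ.*-identityˡ y ⟨
    1ℚ ℚ.* y             ≡⟨ ≡.cong (ℚ._* y) (ℚₚ.*-inverseˡ x) ⟨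
    (1/x ℚ.* x) ℚ.* y    ≡⟨ ℚₚ.*-assoc 1/x x y ⟩
    1/x ℚ.* (x ℚ.* y)    ≡⟨ ≡.cong (1/x ℚ.*_) xy≡0 ⟩
    1/x ℚ.* 0ℚ           ≡⟨ ℚₚ.*-zeroʳ 1/x ⟩
    0ℚ                   ∎)
  where
  open ≡.≡-Reasoning
  instance _ = ℚ.≢-nonZero x≢0
  1/x = ℚ.1/ x

module ℚ[t] where
  open Polynomial ℚₚ.+-*-commutativeRing public
  open NoZeroDivisors (ℚ._≟ 0ℚ) ℚ-zero-product public

module ℚ[t][μ] where
  open Polynomial ℚ[t].polynomialRing public
  open NoZeroDivisors ℚ[t].≈ₚ[]? ℚ[t].⊗-zero-product public

  IsZero₂⇒≈ₚ[] : ∀ {p} → IsZero₂ p → p ≈ₚ []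
  IsZero₂⇒≈ₚ[] = All⇒≈ₚ[] (ℚ[t].All⇒≈ₚ[] (λ z → z))

  ≈ₚ[]⇒IsZero₂ : ∀ p → p ≈ₚ [] → IsZero₂ p
  ≈ₚ[]⇒IsZero₂ = ≈ₚ[]⇒All (λ {x} → ℚ[t].≈ₚ[]⇒All (λ z → z) x)

  TDegreeAtMost : ℕ → P2 → Set
  TDegreeAtMost D = AllCoeffs (ℚ[t].DegreeAtMost D)

  tdeg-mono : ∀ {D D′ p} → D ℕ.≤ D′ → TDegreeAtMost D p → TDegreeAtMost D′ p
  tdeg-mono le d i = ℚ[t].degree-mono le (d i)

  tdeg-[] : ∀ {D} → TDegreeAtMost D []
  tdeg-[] i = ℚ[t].degree-[]

  tdeg-⊕ : ∀ {D} p q → TDegreeAtMost D p → TDegreeAtMost D q → TDegreeAtMost D (p ⊕ q)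
  tdeg-⊕ = AllCoeffs-⊕ ℚ[t].degree-resp ℚ[t].degree-⊕

  tdeg-neg : ∀ {D} p → TDegreeAtMost D p → TDegreeAtMost D (neg p)
  tdeg-neg = AllCoeffs-neg ℚ[t].degree-resp ℚ[t].degree-neg

  tdeg-⊗ : ∀ {D E} p q → TDegreeAtMost D p → TDegreeAtMost E q → TDegreeAtMost (D ℕ.+ E) (p ⊗ q)
  tdeg-⊗ = AllCoeffs-⊗ ℚ[t].degree-resp ℚ[t].degree-[] ℚ[t].degree-⊕ (λ {x} {y} → ℚ[t].degree-⊗ x y)

  tdeg-sum : ∀ {D n} (f : Fin n → P2) → (∀ i → TDegreeAtMost D (f i)) → TDegreeAtMost D (Vector.foldr _⊕_ [] f)
  tdeg-sum {n = zero}  f d = tdeg-[]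
  tdeg-sum {n = suc n} f d = tdeg-⊕ (f zero) _ (d zero) (tdeg-sum (f ∘ suc) (d ∘ suc))

  tdeg-constP : ∀ q → TDegreeAtMost 0 (constP q)
  tdeg-constP q = AllCoeffs-All {Q = ℚ[t].DegreeAtMost 0} ℚ[t].degree-[] (ℚ[t].degree-const q ∷ [])

  tdeg-μP : TDegreeAtMost 0 μP
  tdeg-μP = AllCoeffs-All {Q = ℚ[t].DegreeAtMost 0} ℚ[t].degree-[] (ℚ[t].degree-[] ∷ ℚ[t].degree-const 1ℚ ∷ [])

  tdeg-bounded : ∀ p → ∃ λ D → TDegreeAtMost D p
  tdeg-bounded []      = 0 , tdeg-[]
  tdeg-bounded (c ∷ p) with tdeg-bounded p
  ... | D , d = length c ℕ.+ D , λ
    { zero    → ℚ[t].degree-mono (ℕₚ.m≤m+n (length c) D) (ℚ[t].degree-length c)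
    ; (suc i) → ℚ[t].degree-mono (ℕₚ.m≤n+m D (length c)) (d i) }

  tdeg-bounded-family : ∀ {n} (f : Fin n → P2) → ∃ λ D → ∀ v → TDegreeAtMost D (f v)
  tdeg-bounded-family {zero}  f = 0 , λ ()
  tdeg-bounded-family {suc n} f =
    D ℕ.+ E , λ { zero → tdeg-mono {p = f zero} (ℕₚ.m≤m+n D E) d ; (suc v) → tdeg-mono {p = f (suc v)} (ℕₚ.m≤n+m E D) (e v) }
    where
    D = proj₁ (tdeg-bounded (f zero))
    d = proj₂ (tdeg-bounded (f zero))
    E = proj₁ (tdeg-bounded-family (f ∘ suc))
    e = proj₂ (tdeg-bounded-family (f ∘ suc))

  tP-orbit-bounded⇒zero : ∀ {D} (r : ℕ → P2) → (∀ k → r (suc k) ≈ₚ (tP ⊗ r k)) →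
                          (∀ k → TDegreeAtMost D (r k)) → r 0 ≈ₚ []
  tP-orbit-bounded⇒zero r step bounded = coeffwise λ j →
    ℚ[t].X-orbit-bounded⇒zero (λ k → coeff (r k) j)
      (λ k → ℚ[t].≈ₚ-trans (at (step k) j) (coeff-const⊗ ℚ[t].X (r k) j))
      (λ k → bounded k j)

ℚ[t,μ] : CommutativeRing 0ℓ 0ℓ
ℚ[t,μ] = ℚ[t][μ].polynomialRing

module Fractions where
  open CommutativeRing ℚ[t,μ] hiding (zero)
  open Matrices ℚ[t,μ] using (sum; sum-cong-≋; *-distribʳ-sum)
  open import Relation.Binary.Reasoning.Setoid setoid

  ∏ : ∀ {n} → (Fin n → P2) → P2
  ∏ = Vector.foldr _*_ 1#

  ∏-except : ∀ {n} → (Fin n → P2) → Fin n → P2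
  ∏-except b zero    = ∏ (b ∘ suc)
  ∏-except b (suc v) = b zero * ∏-except (b ∘ suc) v

  ∏-cong : ∀ {n} {b b′ : Fin n → P2} → (∀ i → b i ≈ b′ i) → ∏ b ≈ ∏ b′
  ∏-cong {zero}  e = refl
  ∏-cong {suc n} e = *-cong (e zero) (∏-cong (e ∘ suc))

  ∏-except-cong : ∀ {n} {b b′ : Fin n → P2} → (∀ i → b i ≈ b′ i) → ∀ v → ∏-except b v ≈ ∏-except b′ v
  ∏-except-cong e zero    = ∏-cong (e ∘ suc)
  ∏-except-cong e (suc v) = *-cong (e zero) (∏-except-cong (e ∘ suc) v)

  ∏-except-* : ∀ {n} (b : Fin n → P2) v → ∏-except b v * b v ≈ ∏ b
  ∏-except-* b zero    = *-comm _ (b zero)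
  ∏-except-* b (suc v) = trans (*-assoc (b zero) (∏-except (b ∘ suc) v) (b (suc v))) (*-congˡ {b zero} (∏-except-* (b ∘ suc) v))

  ∏≉0 : ∀ {n} (b : Fin n → P2) → (∀ i → ¬ b i ≈ 0#) → ¬ ∏ b ≈ 0#
  ∏≉0 {zero}  b b≉0 1≈0 = ℚₚ.1≢0 (ℚ[t].at (ℚ[t][μ].at 1≈0 0) 0)
  ∏≉0 {suc n} b b≉0 e =
    [ b≉0 zero , ∏≉0 (b ∘ suc) (b≉0 ∘ suc) ] (ℚ[t][μ].⊗-zero-product (b zero) (∏ (b ∘ suc)) e)

  ∏-except≉0 : ∀ {n} (b : Fin n → P2) → (∀ i → ¬ b i ≈ 0#) → ∀ v → ¬ ∏-except b v ≈ 0#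
  ∏-except≉0 b b≉0 zero    = ∏≉0 (b ∘ suc) (b≉0 ∘ suc)
  ∏-except≉0 b b≉0 (suc v) e =
    [ b≉0 zero , ∏-except≉0 (b ∘ suc) (b≉0 ∘ suc) v ] (ℚ[t][μ].⊗-zero-product (b zero) (∏-except (b ∘ suc) v) e)

  ≈ᴾ⇒≈ : ∀ {p q} → p ≈ᴾ q → p ≈ q
  ≈ᴾ⇒≈ {p} {q} e = x∙y⁻¹≈ε⇒x≈y p q (ℚ[t][μ].IsZero₂⇒≈ₚ[] e)
    where open import Algebra.Properties.Group +-group using (x∙y⁻¹≈ε⇒x≈y)

  ≈⇒≈ᴾ : ∀ {p q} → p ≈ q → p ≈ᴾ q
  ≈⇒≈ᴾ e = ℚ[t][μ].≈ₚ[]⇒IsZero₂ _ (x≈y⇒x∙y⁻¹≈ε e)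
    where open import Algebra.Properties.Group +-group using (x≈y⇒x∙y⁻¹≈ε)

  sumᶠ : ∀ {n} → (Fin n → Frac) → Frac
  sumᶠ = Vector.foldr _+ᶠ_ 0ᶠ

  den-sumᶠ : ∀ {n} (f : Fin n → Frac) → den (sumᶠ f) ≡ ∏ (den ∘ f)
  den-sumᶠ {zero}  f = ≡.refl
  den-sumᶠ {suc n} f = ≡.cong (den (f zero) *_) (den-sumᶠ (f ∘ suc))

  num-sumᶠ : ∀ {n} (f : Fin n → Frac) → num (sumᶠ f) ≈ sum (λ v → num (f v) * ∏-except (den ∘ f) v)
  num-sumᶠ {zero}  f = refl
  num-sumᶠ {suc n} f = begin
    a₀ * den S + num S * b₀
      ≈⟨ +-cong (*-congˡ {a₀} (reflexive (den-sumᶠ (f ∘ suc)))) (*-congʳ {b₀} (num-sumᶠ (f ∘ suc))) ⟩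
    a₀ * ∏ (b ∘ suc) + sum g * b₀
      ≈⟨ +-congˡ (*-distribʳ-sum b₀ g) ⟩
    a₀ * ∏ (b ∘ suc) + sum (λ v → g v * b₀)
      ≈⟨ +-congˡ (sum-cong-≋ λ v → shuffle (num (f (suc v))) (∏-except (b ∘ suc) v)) ⟩
    a₀ * ∏ (b ∘ suc) + sum (λ v → num (f (suc v)) * (b₀ * ∏-except (b ∘ suc) v)) ∎
    where
    S = sumᶠ (f ∘ suc)
    a₀ = num (f zero)
    b = den ∘ f
    b₀ = b zero
    g = λ v → num (f (suc v)) * ∏-except (b ∘ suc) v
    shuffle : ∀ x y → (x * y) * b₀ ≈ x * (b₀ * y)
    shuffle x y = trans (*-assoc x y b₀) (*-congˡ {x} (*-comm y b₀))

  ≈ᶠ-select : ∀ S b → S ≈ᶠ (if b then 1ᶠ else 0ᶠ) → num S ≈ (if b then den S else 0#)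
  ≈ᶠ-select S true  e = trans (sym (*-identityʳ (num S))) (trans (≈ᴾ⇒≈ e) (*-identityˡ (den S)))
  ≈ᶠ-select S false e = trans (sym (*-identityʳ (num S))) (≈ᴾ⇒≈ e)

  clearedRow : ∀ {n} → (Fin n → Frac) → Fin n → P2
  clearedRow x v = num (x v) * ∏-except (den ∘ x) v

  commonDen : ∀ {n} → (Fin n → Frac) → P2
  commonDen x = ∏ (den ∘ x)

  clearDenominators : ∀ {n} (N : Mat n) (M : Fin n → Fin n → P2) → IsIdentity (N · λ v w → ofP (M v w)) →
    ∀ r w → sum (λ v → clearedRow (N r) v * M v w) ≈ (if eqᵇ r w then commonDen (N r) else 0#)
  clearDenominators {n} N M NM≈I r w = begin
    sum (λ v → clearedRow (N r) v * M v w)       ≈⟨ sum-cong-≋ (λ v → cleared v) ⟨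
    sum (λ v → num (f v) * ∏-except (den ∘ f) v) ≈⟨ num-sumᶠ f ⟨
    num (sumᶠ f)                                  ≈⟨ ≈ᶠ-select (sumᶠ f) (eqᵇ r w) row ⟩
    (if eqᵇ r w then den (sumᶠ f) else 0#)        ≈⟨ if-cong (eqᵇ r w) (trans (reflexive (den-sumᶠ f)) (∏-cong den-f)) ⟩
    (if eqᵇ r w then commonDen (N r) else 0#)     ∎
    where
    f : Fin n → Frac
    f v = N r v *ᶠ ofP (M v w)
    row : sumᶠ f ≈ᶠ (if eqᵇ r w then 1ᶠ else 0ᶠ)
    row = ≡.subst (_≈ᶠ (if eqᵇ r w then 1ᶠ else 0ᶠ)) (Σᶠ≡foldr 0ᶠ _+ᶠ_ f) (NM≈I r w)
    den-f : ∀ v → den (f v) ≈ den (N r v)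
    den-f v = *-identityʳ (den (N r v))
    cleared : ∀ v → num (f v) * ∏-except (den ∘ f) v ≈ clearedRow (N r) v * M v w
    cleared v = begin
      (num (N r v) * M v w) * ∏-except (den ∘ f) v         ≈⟨ *-congˡ {num (N r v) * M v w} (∏-except-cong den-f v) ⟩
      (num (N r v) * M v w) * ∏-except (den ∘ N r) v       ≈⟨ *-assoc (num (N r v)) (M v w) _ ⟩
      num (N r v) * (M v w * ∏-except (den ∘ N r) v)       ≈⟨ *-congˡ {num (N r v)} (*-comm (M v w) _) ⟩
      num (N r v) * (∏-except (den ∘ N r) v * M v w)       ≈⟨ *-assoc (num (N r v)) _ (M v w) ⟨
      clearedRow (N r) v * M v w                           ∎
    if-cong : ∀ b {x y} → x ≈ y → (if b then x else 0#) ≈ (if b then y else 0#)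
    if-cong true  e = e
    if-cong false e = refl

  cross-multiply : ∀ a b e a′ b′ e′ → ¬ e ≈ 0# → ¬ e′ ≈ 0# →
    (e′ * b′) * (a * e) ≈ (e * b) * (a′ * e′) → (a ∕ b) ≈ᶠ (a′ ∕ b′)
  cross-multiply a b e a′ b′ e′ e≉0 e′≉0 eq =
    conclude (ℚ[t][μ].⊗-zero-product (e * e′) (a * b′ - a′ * b) vanishes)
    where
    open import Algebra.Properties.Ring ring using (x[y-z]≈xy-xz)
    open import Algebra.Properties.CommutativeSemigroup *-commutativeSemigroup using (interchange)
    open import Algebra.Properties.Group +-group using (x∙y⁻¹≈ε⇒x≈y)
    ee′·ab′≈e′b′·ae : (e * e′) * (a * b′) ≈ (e′ * b′) * (a * e)
    ee′·ab′≈e′b′·ae = trans (*-cong (*-comm e e′) (*-comm a b′)) (trans (interchange e′ e b′ a) (*-congˡ {e′ * b′} (*-comm e a)))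
    ee′·a′b≈eb·a′e′ : (e * e′) * (a′ * b) ≈ (e * b) * (a′ * e′)
    ee′·a′b≈eb·a′e′ = trans (*-congˡ {e * e′} (*-comm a′ b)) (trans (interchange e e′ b a′) (*-congˡ {e * b} (*-comm e′ a′)))
    vanishes : (e * e′) * (a * b′ - a′ * b) ≈ 0#
    vanishes = begin
      (e * e′) * (a * b′ - a′ * b)              ≈⟨ x[y-z]≈xy-xz (e * e′) (a * b′) (a′ * b) ⟩
      (e * e′) * (a * b′) - (e * e′) * (a′ * b) ≈⟨ +-cong ee′·ab′≈e′b′·ae (-‿cong ee′·a′b≈eb·a′e′) ⟩
      (e′ * b′) * (a * e) - (e * b) * (a′ * e′) ≈⟨ +-congʳ eq ⟩
      (e * b) * (a′ * e′) - (e * b) * (a′ * e′) ≈⟨ -‿inverseʳ ((e * b) * (a′ * e′)) ⟩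
      0#                                        ∎
    conclude : e * e′ ≈ 0# ⊎ a * b′ - a′ * b ≈ 0# → (a ∕ b) ≈ᶠ (a′ ∕ b′)
    conclude (inj₂ ab′-a′b≈0) = ≈⇒≈ᴾ (x∙y⁻¹≈ε⇒x≈y (a * b′) (a′ * b) ab′-a′b≈0)
    conclude (inj₁ ee′≈0)     = ⊥-elim ([ e≉0 , e′≉0 ] (ℚ[t][μ].⊗-zero-product e e′ ee′≈0))

  den≉0 : ∀ f → Valid f → ¬ den f ≈ 0#
  den≉0 f valid den≈0 = valid (ℚ[t][μ].≈ₚ[]⇒IsZero₂ (den f) den≈0)

  proportional-cleared⇒≈ᶠ : ∀ {n} (x x′ : Fin n → Frac) → (∀ v → Valid (x v)) → (∀ v → Valid (x′ v)) →
    ∀ v v′ → commonDen x′ * clearedRow x v ≈ commonDen x * clearedRow x′ v′ → x v ≈ᶠ x′ v′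
  proportional-cleared⇒≈ᶠ x x′ valid valid′ v v′ eq =
    cross-multiply (num (x v)) (den (x v)) (∏-except (den ∘ x) v) (num (x′ v′)) (den (x′ v′)) (∏-except (den ∘ x′) v′)
      (∏-except≉0 (den ∘ x) (λ i → den≉0 (x i) (valid i)) v) (∏-except≉0 (den ∘ x′) (λ i → den≉0 (x′ i) (valid′ i)) v′)
      (trans (*-congʳ {clearedRow x v} (∏-except-* (den ∘ x′) v′)) (trans eq (*-congʳ {clearedRow x′ v′} (sym (∏-except-* (den ∘ x) v)))))

module Recurrence where
  open CommutativeRing ℚ[t,μ] hiding (zero)
  open ℚ[t][μ] using (TDegreeAtMost; tdeg-⊕; tdeg-neg; tdeg-⊗; tdeg-mono; tdeg-bounded; tP-orbit-bounded⇒zero)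
  open import Algebra.Properties.Ring ring using (x[y-z]≈xy-xz)
  open import Algebra.Properties.Group +-group using (x∙y⁻¹≈ε⇒x≈y)
  open import Algebra.Properties.CommutativeSemigroup +-commutativeSemigroup using (interchange)
  open import Algebra.Properties.CommutativeSemigroup *-commutativeSemigroup using (x∙yz≈y∙xz)
  open import Relation.Binary.Reasoning.Setoid setoid

  private
    cancel-middle : ∀ p q r q′ → q ≈ q′ → (p - q) - (r - q′) ≈ p - r
    cancel-middle p q r q′ q≈q′ = begin
      (p - q) - (r - q′)      ≈⟨ +-congˡ {p - q} (⁻¹-anti-homo‿- r q′) ⟩
      (p - q) + (q′ - r)      ≈⟨ +-congˡ {p - q} (+-comm q′ (- r)) ⟩
      (p - q) + (- r + q′)    ≈⟨ interchange p (- q) (- r) q′ ⟩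
      (p - r) + (- q + q′)    ≈⟨ +-congˡ {p - r} (trans (+-congˡ { - q} (sym q≈q′)) (-‿inverseˡ q)) ⟩
      (p - r) + 0#            ≈⟨ +-identityʳ (p - r) ⟩
      p - r                   ∎
      where open import Algebra.Properties.AbelianGroup +-abelianGroup using (⁻¹-anti-homo‿-)

  bounded-solutions-agree : ∀ {D D′} (c c′ : P2) (b b′ Y Y′ : ℕ → P2) → (∀ L → b L ≈ b′ L) →
    (∀ L → Y (suc L) ≈ tP * Y L - c * b L) → (∀ L → Y′ (suc L) ≈ tP * Y′ L - c′ * b′ L) →
    (∀ L → TDegreeAtMost D (Y L)) → (∀ L → TDegreeAtMost D′ (Y′ L)) → c′ * Y 0 ≈ c * Y′ 0
  bounded-solutions-agree {D} {D′} c c′ b b′ Y Y′ b≈b′ Y-suc Y′-suc Y-bounded Y′-bounded =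
    x∙y⁻¹≈ε⇒x≈y (c′ * Y 0) (c * Y′ 0) (tP-orbit-bounded⇒zero r r-suc r-bounded)
    where
    r : ℕ → P2
    r L = c′ * Y L - c * Y′ L
    r-suc : ∀ L → r (suc L) ≈ tP * r L
    r-suc L = begin
      c′ * Y (suc L) - c * Y′ (suc L)
        ≈⟨ +-cong (*-congˡ {c′} (Y-suc L)) (-‿cong (*-congˡ {c} (Y′-suc L))) ⟩
      c′ * (tP * Y L - c * b L) - c * (tP * Y′ L - c′ * b′ L)
        ≈⟨ +-cong (x[y-z]≈xy-xz c′ (tP * Y L) (c * b L)) (-‿cong (x[y-z]≈xy-xz c (tP * Y′ L) (c′ * b′ L))) ⟩
      (c′ * (tP * Y L) - c′ * (c * b L)) - (c * (tP * Y′ L) - c * (c′ * b′ L))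
        ≈⟨ cancel-middle (c′ * (tP * Y L)) (c′ * (c * b L)) (c * (tP * Y′ L)) (c * (c′ * b′ L)) c′cb≈cc′b′ ⟩
      c′ * (tP * Y L) - c * (tP * Y′ L)
        ≈⟨ +-cong (x∙yz≈y∙xz c′ tP (Y L)) (-‿cong (x∙yz≈y∙xz c tP (Y′ L))) ⟩
      tP * (c′ * Y L) - tP * (c * Y′ L)
        ≈⟨ x[y-z]≈xy-xz tP (c′ * Y L) (c * Y′ L) ⟨
      tP * r L ∎
      where
      c′cb≈cc′b′ : c′ * (c * b L) ≈ c * (c′ * b′ L)
      c′cb≈cc′b′ = trans (x∙yz≈y∙xz c′ c (b L)) (*-congˡ {c} (*-congˡ {c′} (b≈b′ L)))
    Dc = proj₁ (tdeg-bounded c)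
    Dc′ = proj₁ (tdeg-bounded c′)
    r-bounded : ∀ L → TDegreeAtMost ((Dc′ ℕ.+ D) ℕ.+ (Dc ℕ.+ D′)) (r L)
    r-bounded L = tdeg-⊕ (c′ * Y L) (- (c * Y′ L))
      (tdeg-mono {p = c′ * Y L} (ℕₚ.m≤m+n (Dc′ ℕ.+ D) (Dc ℕ.+ D′))
        (tdeg-⊗ c′ (Y L) (proj₂ (tdeg-bounded c′)) (Y-bounded L)))
      (tdeg-neg (c * Y′ L) (tdeg-mono {p = c * Y′ L} (ℕₚ.m≤n+m (Dc ℕ.+ D′) (Dc′ ℕ.+ D))
        (tdeg-⊗ c (Y′ L) (proj₂ (tdeg-bounded c)) (Y′-bounded L))))

eqᵇ-refl : ∀ {n} (u : Fin n) → eqᵇ u u ≡ true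
eqᵇ-refl u = dec-true (u ≟ u) ≡.refl

module Walks {n} (G : Graph n) where
  private
    module ℕΣ where
      open SelectingSums ℕₚ.+-0-commutativeMonoid public
      open import Algebra.Properties.Monoid.Sum ℕₚ.+-0-monoid public using (sum; sum-cong-≗)

  walks-1 : ∀ u v → walks G 1 u v ≡ (if Adj G u v then 1 else 0)
  walks-1 u v = begin
    Σᶠ 0 ℕ._+_ (λ w → if Adj G u w then (if eqᵇ w v then 1 else 0) else 0)
      ≡⟨ Σᶠ≡foldr 0 ℕ._+_ (λ w → if Adj G u w then walks G 0 w v else 0) ⟩
    ℕΣ.sum (λ w → if Adj G u w then (if eqᵇ w v then 1 else 0) else 0)
      ≡⟨ ℕΣ.sum-cong-≗ (λ w → swap-if (Adj G u w) (eqᵇ w v)) ⟩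
    ℕΣ.sum (λ w → if eqᵇ w v then (if Adj G u w then 1 else 0) else 0)
      ≡⟨ ℕΣ.sum-selectˡ (λ w → if Adj G u w then 1 else 0) v ⟩
    (if Adj G u v then 1 else 0) ∎
    where
    open ≡.≡-Reasoning
    swap-if : ∀ a b → (if a then (if b then 1 else 0) else 0) ≡ (if b then (if a then 1 else 0) else 0)
    swap-if true  b     = ≡.refl
    swap-if false true  = ≡.refl
    swap-if false false = ≡.refl

  walks-2 : ∀ u → walks G 2 u u ≡ degree G u
  walks-2 u = ≡.trans (Σᶠ≡foldr 0 ℕ._+_ (λ w → if Adj G u w then walks G 1 w u else 0))
    (≡.trans (ℕΣ.sum-cong-≗ {n} back-and-forth) (≡.sym (Σᶠ≡foldr 0 ℕ._+_ (λ w → if Adj G u w then 1 else 0))))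
    where
    back-and-forth : ∀ w → (if Adj G u w then walks G 1 w u else 0) ≡ (if Adj G u w then 1 else 0)
    back-and-forth w with Adj G u w in uw
    ... | false = ≡.refl
    ... | true  = ≡.trans (walks-1 w u) (≡.cong (λ b → if b then 1 else 0) (≡.trans (Graph.sym G w u) uw))

  walkRegular⇒regular : WalkRegular G → ∀ u v → degree G u ≡ degree G v
  walkRegular⇒regular wr u v = ≡.trans (≡.sym (walks-2 u)) (≡.trans (wr 1 u v) (walks-2 v))

module Adjacency {n} (G : Graph n) where
  open CommutativeRing ℚ[t,μ] hiding (zero)
  open Matrices ℚ[t,μ]
  open import Algebra.Properties.Monoid.Mult +-monoid using (_×_; ×-homo-+)
  open import Relation.Binary.Reasoning.Setoid setoid

  adjacency : Matrix n
  adjacency u w = if Adj G u w then 1# else 0#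

  ×1#-sum : ∀ {k} (f : Fin k → ℕ) → Vector.foldr ℕ._+_ 0 f × 1# ≈ sum (λ i → f i × 1#)
  ×1#-sum {zero}  f = refl
  ×1#-sum {suc k} f = trans (×-homo-+ 1# (f zero) _) (+-congˡ (×1#-sum (f ∘ suc)))

  adjacency^≈walks : ∀ j u v → (adjacency ^ᴹ j) u v ≈ walks G j u v × 1#
  adjacency^≈walks zero u v with eqᵇ u v
  ... | true  = sym (+-identityʳ 1#)
  ... | false = refl
  adjacency^≈walks (suc j) u v = begin
    sum (λ w → adjacency u w * (adjacency ^ᴹ j) w v)   ≈⟨ sum-cong-≋ (λ w → *-congˡ {adjacency u w} (adjacency^≈walks j w v)) ⟩
    sum (λ w → adjacency u w * (walks G j w v × 1#))   ≈⟨ sum-cong-≋ (λ w → select-×1# (Adj G u w) (walks G j w v)) ⟩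
    sum (λ w → f w × 1#)                               ≈⟨ ×1#-sum f ⟨
    Vector.foldr ℕ._+_ 0 f × 1#                        ≡⟨ ≡.cong (_× 1#) (Σᶠ≡foldr 0 ℕ._+_ f) ⟨
    walks G (suc j) u v × 1#                           ∎
    where
    f = λ w → if Adj G u w then walks G j w v else 0
    select-×1# : ∀ b k → (if b then 1# else 0#) * (k × 1#) ≈ (if b then k else 0) × 1#
    select-×1# true  k = *-identityˡ (k × 1#)
    select-×1# false k = zeroˡ (k × 1#)

module Perturbation {n} (G : Graph n) (d : ℕ) (s : Bool) (m : ℕ) (us vs : Fin m → Fin n) where
  open CommutativeRing ℚ[t,μ] hiding (zero)
  open Matrices ℚ[t,μ]
  open Adjacency G using (adjacency)
  open ℚ[t][μ] using (TDegreeAtMost; tdeg-[]; tdeg-⊕; tdeg-neg; tdeg-⊗; tdeg-sum; tdeg-constP; tdeg-μP)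
  open import Algebra.Properties.AbelianGroup +-abelianGroup using (⁻¹-∙-comm; ⁻¹-involutive)
  open import Relation.Binary.Reasoning.Setoid setoid

  μd : P2
  μd = μP * constP (+ d ℚ./ 1)

  sign : P2
  sign = if s then 1# else - 1#

  εs : Fin m → P2
  εs i = εP (us i) (vs i)

  B : Matrix n
  B = adjacency -ᴹ μd ·ᴹ 1ᴹ -ᴹ sign ·ᴹ unitSum us vs εs

  pertMatrix≈tI-B : (∀ x → degree G x ≡ d) → ∀ x y → num (pertMatrix G s m us vs x y) ≈ (tP ·ᴹ 1ᴹ -ᴹ B) x y
  pertMatrix≈tI-B regular x y = begin
    diag + (adj + signP s pert)
      ≈⟨ +-cong (diag-split (eqᵇ x y) (degree G x) (regular x)) (+-cong (adj-neg (Adj G x y)) (sign-split s)) ⟩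
    (tP * δ + μd * δ) + (- adjacency x y + sign * E x y)
      ≈⟨ rearrange (tP * δ) (μd * δ) (adjacency x y) (sign * E x y) ⟩
    tP * δ - B x y ∎
    where
    δ = 1ᴹ x y
    diag = if eqᵇ x y then tP + μP * constP (+ degree G x ℚ./ 1) else 0#
    adj = if Adj G x y then constP (ℚ.- 1ℚ) else 0#
    E = unitSum us vs εs
    entry = λ i → if eqᵇ x (us i) ∧ eqᵇ y (vs i) then εs i else 0#
    pert = Σᶠ 0# _+_ entry
    diag-split : ∀ b k → k ≡ d →
      (if b then tP + μP * constP (+ k ℚ./ 1) else 0#) ≈ tP * (if b then 1# else 0#) + μd * (if b then 1# else 0#)
    diag-split true  k ≡.refl = sym (+-cong (*-identityʳ tP) (*-identityʳ μd))
    diag-split false k _      = sym (trans (+-cong (zeroʳ tP) (zeroʳ μd)) (+-identityˡ 0#))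
    adj-neg : ∀ b → (if b then constP (ℚ.- 1ℚ) else 0#) ≈ - (if b then 1# else 0#)
    adj-neg true  = refl
    adj-neg false = refl
    sign-split : ∀ b → signP b pert ≈ (if b then 1# else - 1#) * E x y
    sign-split true  = trans (reflexive (Σᶠ≡foldr 0# _+_ entry)) (sym (*-identityˡ (E x y)))
    sign-split false = trans (-‿cong (reflexive (Σᶠ≡foldr 0# _+_ entry))) (sym (-1*x≈-x (E x y)))
      where open import Algebra.Properties.Ring ring using (-1*x≈-x)
    rearrange : ∀ t c a p → (t + c) + (- a + p) ≈ t - ((a - c) - p)
    rearrange t c a p = begin
      (t + c) + (- a + p)      ≈⟨ +-assoc t c (- a + p) ⟩
      t + (c + (- a + p))      ≈⟨ +-congˡ {t} (sym (+-assoc c (- a) p)) ⟩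
      t + ((c + - a) + p)      ≈⟨ +-congˡ {t} (+-congʳ (trans (+-comm c (- a)) (+-congˡ { - a} (sym (⁻¹-involutive c))))) ⟩
      t + ((- a + - - c) + p)  ≈⟨ +-congˡ {t} (+-cong (⁻¹-∙-comm a (- c)) (sym (⁻¹-involutive p))) ⟩
      t + (- (a - c) + - - p)  ≈⟨ +-congˡ {t} (⁻¹-∙-comm (a - c) (- p)) ⟩
      t - ((a - c) - p)        ∎

  private
    tdeg-if : ∀ {D} b {p q} → TDegreeAtMost D p → TDegreeAtMost D q → TDegreeAtMost D (if b then p else q)
    tdeg-if true  dp dq = dp
    tdeg-if false dp dq = dq

    tdeg-1ᴹ : ∀ x y → TDegreeAtMost 0 (1ᴹ {n} x y)
    tdeg-1ᴹ x y = tdeg-if (eqᵇ x y) (tdeg-constP 1ℚ) tdeg-[]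

  B-tFree : ∀ x y → TDegreeAtMost 0 (B x y)
  B-tFree x y = tdeg-⊕ (adjacency x y - μd * 1ᴹ x y) (- (sign * E x y))
    (tdeg-⊕ (adjacency x y) (- (μd * 1ᴹ x y)) (tdeg-if (Adj G x y) (tdeg-constP 1ℚ) tdeg-[])
      (tdeg-neg (μd * 1ᴹ x y) (tdeg-⊗ μd (1ᴹ x y) (tdeg-⊗ μP (constP (+ d ℚ./ 1)) tdeg-μP (tdeg-constP (+ d ℚ./ 1))) (tdeg-1ᴹ x y))))
    (tdeg-neg (sign * E x y) (tdeg-⊗ sign (E x y)
      (tdeg-if s (tdeg-constP 1ℚ) (tdeg-neg (constP 1ℚ) (tdeg-constP 1ℚ))) (tdeg-sum entry entry-tFree)))
    where
    E = unitSum us vs εs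
    entry = λ i → if eqᵇ x (us i) ∧ eqᵇ y (vs i) then εs i else 0#
    entry-tFree : ∀ i → TDegreeAtMost 0 (entry i)
    entry-tFree i = tdeg-if (eqᵇ x (us i) ∧ eqᵇ y (vs i))
      (tdeg-if (eqᵇ (us i) (vs i)) (tdeg-neg μP tdeg-μP) (tdeg-constP 1ℚ)) tdeg-[]

  B^-tFree : ∀ k x y → TDegreeAtMost 0 ((B ^ᴹ k) x y)
  B^-tFree zero    x y = tdeg-1ᴹ x y
  B^-tFree (suc k) x y = tdeg-sum (λ w → B x w * (B ^ᴹ k) w y) λ w → tdeg-⊗ (B x w) ((B ^ᴹ k) w y) (B-tFree x w) (B^-tFree k w y)

  adjacency^*B^-suc : ∀ j k u v → (adjacency ^ᴹ j *ᴹ B ^ᴹ suc k) u v ≈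
    (adjacency ^ᴹ suc j *ᴹ B ^ᴹ k) u v - μd * (adjacency ^ᴹ j *ᴹ B ^ᴹ k) u v
      - sign * sum (λ i → (adjacency ^ᴹ j) u (us i) * (εs i * (B ^ᴹ k) (vs i) v))
  adjacency^*B^-suc j k u v = trans (*ᴹ-expand μd sign adjacency E Aʲ Bᵏ u v)
    (-ᴹ-cong (-ᴹ-cong absorb (≋-refl {X = μd ·ᴹ (Aʲ *ᴹ Bᵏ)})) (λ u v → *-congˡ {sign} (unfold u v)) u v)
    where
    E = unitSum us vs εs
    Aʲ = adjacency ^ᴹ j
    Bᵏ = B ^ᴹ k
    absorb : Aʲ *ᴹ (adjacency *ᴹ Bᵏ) ≋ adjacency ^ᴹ suc j *ᴹ Bᵏ
    absorb = ≋-trans (≋-sym (*ᴹ-assoc Aʲ adjacency Bᵏ)) (*ᴹ-cong (^ᴹ-suc-comm adjacency j) ≋-refl)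
    unfold : ∀ u v → (Aʲ *ᴹ (E *ᴹ Bᵏ)) u v ≈ sum (λ i → Aʲ u (us i) * (εs i * Bᵏ (vs i) v))
    unfold u v = trans (sym (*ᴹ-assoc Aʲ E Bᵏ u v)) (*ᴹ-unitSum-*ᴹ us vs εs Aʲ Bᵏ u v)

module CliqueEmbedding {n} (G : Graph n) (1wr : OneWalkRegular G) (K K′ : Subset n)
  (K-clique : IsClique G K) (K′-clique : IsClique G K′) (σ : Fin n → Fin n)
  (σ-maps : ∀ x → x ∈ K → σ x ∈ K′) (σ-injective : ∀ x y → x ∈ K → y ∈ K → σ x ≡ σ y → x ≡ y) where

  open CommutativeRing ℚ[t,μ] hiding (zero)
  open Matrices ℚ[t,μ]
  open Adjacency G
  open import Relation.Binary.Reasoning.Setoid setoid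

  eqᵇ-σ : ∀ {u v} → u ∈ K → v ∈ K → eqᵇ (σ u) (σ v) ≡ eqᵇ u v
  eqᵇ-σ {u} {v} u∈K v∈K with u ≟ v
  ... | yes ≡.refl = eqᵇ-refl (σ u)
  ... | no  u≢v    = dec-false (σ u ≟ σ v) (u≢v ∘ σ-injective u v u∈K v∈K)

  -- distinct clique vertices are adjacent, so 1-walk-regularity applies to them
  walks-σ : ∀ j {u v} → u ∈ K → v ∈ K → walks G j u v ≡ walks G j (σ u) (σ v)
  walks-σ j {u} {v} u∈K v∈K with u ≟ v
  walks-σ zero    u∈K v∈K | yes ≡.refl = ≡.cong (λ b → if b then 1 else 0) (≡.sym (eqᵇ-σ u∈K u∈K))
  walks-σ (suc k) {u} u∈K v∈K | yes ≡.refl = proj₁ 1wr k u (σ u)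
  walks-σ j {u} {v} u∈K v∈K | no u≢v = proj₂ 1wr j u v (σ u) (σ v) (K-clique u v u∈K v∈K u≢v)
    (K′-clique (σ u) (σ v) (σ-maps u u∈K) (σ-maps v v∈K) (u≢v ∘ σ-injective u v u∈K v∈K))

  adjacency^-σ : ∀ j {u v} → u ∈ K → v ∈ K → (adjacency ^ᴹ j) u v ≈ (adjacency ^ᴹ j) (σ u) (σ v)
  adjacency^-σ j {u} {v} u∈K v∈K = begin
    (adjacency ^ᴹ j) u v          ≈⟨ adjacency^≈walks j u v ⟩
    walks G j u v × 1#            ≡⟨ ≡.cong (_× 1#) (walks-σ j u∈K v∈K) ⟩
    walks G j (σ u) (σ v) × 1#    ≈⟨ adjacency^≈walks j (σ u) (σ v) ⟨
    (adjacency ^ᴹ j) (σ u) (σ v)  ∎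
    where open import Algebra.Properties.Monoid.Mult +-monoid using (_×_)

  module _ (d : ℕ) (s : Bool) {m} (us vs : Fin m → Fin n) (us∈K : ∀ i → us i ∈ K) (vs∈K : ∀ i → vs i ∈ K) where
    private
      module P  = Perturbation G d s m us vs
      module Pσ = Perturbation G d s m (σ ∘ us) (σ ∘ vs)

    εs-σ : ∀ i → Pσ.εs i ≡ P.εs i
    εs-σ i = ≡.cong (λ b → if b then - μP else 1#) (eqᵇ-σ (us∈K i) (vs∈K i))

    B^-σ : ∀ k {u v} → u ∈ K → v ∈ K → (P.B ^ᴹ k) u v ≈ (Pσ.B ^ᴹ k) (σ u) (σ v)

    adjacency^*B^-σ : ∀ k j {u v} → u ∈ K → v ∈ K →
      (adjacency ^ᴹ j *ᴹ P.B ^ᴹ k) u v ≈ (adjacency ^ᴹ j *ᴹ Pσ.B ^ᴹ k) (σ u) (σ v)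
    adjacency^*B^-σ zero j {u} {v} u∈K v∈K = begin
      (adjacency ^ᴹ j *ᴹ 1ᴹ) u v          ≈⟨ *ᴹ-identityʳ (adjacency ^ᴹ j) u v ⟩
      (adjacency ^ᴹ j) u v                ≈⟨ adjacency^-σ j u∈K v∈K ⟩
      (adjacency ^ᴹ j) (σ u) (σ v)        ≈⟨ *ᴹ-identityʳ (adjacency ^ᴹ j) (σ u) (σ v) ⟨
      (adjacency ^ᴹ j *ᴹ 1ᴹ) (σ u) (σ v)  ∎
    adjacency^*B^-σ (suc k) j {u} {v} u∈K v∈K = begin
      (adjacency ^ᴹ j *ᴹ P.B ^ᴹ suc k) u v
        ≈⟨ P.adjacency^*B^-suc j k u v ⟩
      (adjacency ^ᴹ suc j *ᴹ P.B ^ᴹ k) u v - P.μd * (adjacency ^ᴹ j *ᴹ P.B ^ᴹ k) u v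
        - P.sign * sum (λ i → (adjacency ^ᴹ j) u (us i) * (P.εs i * (P.B ^ᴹ k) (vs i) v))
        ≈⟨ +-cong (+-cong (adjacency^*B^-σ k (suc j) u∈K v∈K) (-‿cong (*-congˡ {P.μd} (adjacency^*B^-σ k j u∈K v∈K))))
                  (-‿cong (*-congˡ {P.sign} (sum-cong-≋ λ i →
                     *-cong (adjacency^-σ j u∈K (us∈K i)) (*-cong (reflexive (≡.sym (εs-σ i))) (B^-σ k (vs∈K i) v∈K))))) ⟩
      (adjacency ^ᴹ suc j *ᴹ Pσ.B ^ᴹ k) (σ u) (σ v) - Pσ.μd * (adjacency ^ᴹ j *ᴹ Pσ.B ^ᴹ k) (σ u) (σ v)
        - Pσ.sign * sum (λ i → (adjacency ^ᴹ j) (σ u) (σ (us i)) * (Pσ.εs i * (Pσ.B ^ᴹ k) (σ (vs i)) (σ v)))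
        ≈⟨ Pσ.adjacency^*B^-suc j k (σ u) (σ v) ⟨
      (adjacency ^ᴹ j *ᴹ Pσ.B ^ᴹ suc k) (σ u) (σ v) ∎

    B^-σ k {u} {v} u∈K v∈K = trans (sym (*ᴹ-identityˡ (P.B ^ᴹ k) u v))
      (trans (adjacency^*B^-σ k zero u∈K v∈K) (*ᴹ-identityˡ (Pσ.B ^ᴹ k) (σ u) (σ v)))

module Row {n} (G : Graph n) (d : ℕ) (regular : ∀ x → degree G x ≡ d) (s : Bool) (m : ℕ)
  (us vs : Fin m → Fin n) (N : Mat n) (N-inverse : IsInverse (pertMatrix G s m us vs) N) (r : Fin n) where

  open CommutativeRing ℚ[t,μ] hiding (zero)
  open Matrices ℚ[t,μ]
  open Fractions
  open Perturbation G d s m us vs using (B; pertMatrix≈tI-B; B^-tFree)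
  open ℚ[t][μ] using (TDegreeAtMost; tdeg-mono; tdeg-sum; tdeg-⊗; tdeg-bounded-family)
  open import Relation.Binary.Reasoning.Setoid setoid

  x̃ : Fin n → P2
  x̃ = clearedRow (N r)

  c : P2
  c = commonDen (N r)

  -- a matrix all of whose rows are x̃, so that x̃ B^L is a row of a matrix product
  X̃ : Matrix n
  X̃ _ = x̃

  Eᵣ : Matrix n
  Eᵣ _ w = 1ᴹ r w

  X̃B : X̃ *ᴹ B ≋ tP ·ᴹ X̃ -ᴹ c ·ᴹ Eᵣ
  X̃B u w = solve-for (X̃ *ᴹ B) u w (begin
    tP * x̃ w - (X̃ *ᴹ B) u w                 ≈⟨ -ᴹ-cong (λ _ w → trans (*ᴹ-·ᴹʳ tP X̃ 1ᴹ u w) (*-congˡ {tP} (*ᴹ-identityʳ X̃ u w)))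
                                                     (≋-refl {X = X̃ *ᴹ B}) u w ⟨
    (X̃ *ᴹ (tP ·ᴹ 1ᴹ) -ᴹ X̃ *ᴹ B) u w        ≈⟨ *ᴹ-distribˡ--ᴹ X̃ (tP ·ᴹ 1ᴹ) B u w ⟨
    (X̃ *ᴹ (tP ·ᴹ 1ᴹ -ᴹ B)) u w              ≈⟨ sum-cong-≋ (λ v → *-congˡ {x̃ v} (pertMatrix≈tI-B regular v w)) ⟨
    sum (λ v → x̃ v * num (M v w))            ≈⟨ clearDenominators N (λ v w → num (M v w)) (proj₂ (proj₂ N-inverse)) r w ⟩
    (if eqᵇ r w then c else 0#)              ≈⟨ select (eqᵇ r w) ⟩
    c * Eᵣ u w                                ∎)
    where
    M = pertMatrix G s m us vs
    select : ∀ b → (if b then c else 0#) ≈ c * (if b then 1# else 0#)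
    select true  = sym (*-identityʳ c)
    select false = sym (zeroʳ c)
    solve-for : ∀ (Z : Matrix n) u w → tP * x̃ w - Z u w ≈ c * Eᵣ u w → Z u w ≈ tP * x̃ w - c * Eᵣ u w
    solve-for Z u w e = begin
      Z u w                           ≈⟨ xyx⁻¹≈y (tP * x̃ w) (Z u w) ⟨
      (tP * x̃ w + Z u w) - tP * x̃ w  ≈⟨ +-assoc (tP * x̃ w) (Z u w) (- (tP * x̃ w)) ⟩
      tP * x̃ w + (Z u w - tP * x̃ w)  ≈⟨ +-congˡ {tP * x̃ w} (⁻¹-anti-homo‿- (tP * x̃ w) (Z u w)) ⟨
      tP * x̃ w - (tP * x̃ w - Z u w)  ≈⟨ +-congˡ {tP * x̃ w} (-‿cong e) ⟩
      tP * x̃ w - c * Eᵣ u w            ∎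
      where open import Algebra.Properties.AbelianGroup +-abelianGroup using (xyx⁻¹≈y; ⁻¹-anti-homo‿-)

  Y : ℕ → Fin n → P2
  Y L col = (X̃ *ᴹ B ^ᴹ L) r col

  Y-zero : ∀ col → Y 0 col ≈ x̃ col
  Y-zero col = *ᴹ-identityʳ X̃ r col

  Y-suc : ∀ L col → Y (suc L) col ≈ tP * Y L col - c * (B ^ᴹ L) r col
  Y-suc L col = begin
    (X̃ *ᴹ (B *ᴹ Bᴸ)) r col                                ≈⟨ *ᴹ-assoc X̃ B Bᴸ r col ⟨
    (X̃ *ᴹ B *ᴹ Bᴸ) r col                                  ≈⟨ *ᴹ-cong X̃B (≋-refl {X = Bᴸ}) r col ⟩
    ((tP ·ᴹ X̃ -ᴹ c ·ᴹ Eᵣ) *ᴹ Bᴸ) r col                     ≈⟨ *ᴹ-distribʳ--ᴹ Bᴸ (tP ·ᴹ X̃) (c ·ᴹ Eᵣ) r col ⟩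
    (tP ·ᴹ X̃ *ᴹ Bᴸ) r col - (c ·ᴹ Eᵣ *ᴹ Bᴸ) r col          ≈⟨ +-cong (*ᴹ-·ᴹˡ tP X̃ Bᴸ r col) (-‿cong (*ᴹ-·ᴹˡ c Eᵣ Bᴸ r col)) ⟩
    tP * Y L col - c * (1ᴹ *ᴹ Bᴸ) r col                    ≈⟨ +-congˡ {tP * Y L col} (-‿cong (*-congˡ {c} (*ᴹ-identityˡ Bᴸ r col))) ⟩
    tP * Y L col - c * Bᴸ r col                            ∎
    where Bᴸ = B ^ᴹ L

  Y-bounded : ∃ λ D → ∀ L col → TDegreeAtMost D (Y L col)
  Y-bounded = D , λ L col → tdeg-sum (λ w → x̃ w * (B ^ᴹ L) w col) λ w →
    tdeg-mono {p = x̃ w * (B ^ᴹ L) w col} (ℕₚ.≤-reflexive (ℕₚ.+-identityʳ D))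
      (tdeg-⊗ (x̃ w) ((B ^ᴹ L) w col) (proj₂ x̃-bounded w) (B^-tFree L w col))
    where
    x̃-bounded = tdeg-bounded-family x̃
    D = proj₁ x̃-bounded

open CommutativeRing ℚ[t,μ] using (_≈_; _*_; *-congˡ; setoid)
open Matrices ℚ[t,μ] using (_^ᴹ_)
open Fractions using (proportional-cleared⇒≈ᶠ)
open Recurrence using (bounded-solutions-agree)
open import Relation.Binary.Reasoning.Setoid setoid

mainTheorem9 : ∀ {n} (G : Graph n) → OneWalkRegular G →
    (s : Bool) (m : ℕ) (us vs : Fin m → Fin n) (ur vr : Fin n) →
    (K K' : Subset n) → IsClique G K → IsClique G K' →
    (∀ i → us i ∈ K) → (∀ i → vs i ∈ K) → ur ∈ K → vr ∈ K →
    (σ : Fin n → Fin n) → (∀ x → x ∈ K → σ x ∈ K') →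
    (∀ x y → x ∈ K → y ∈ K → σ x ≡ σ y → x ≡ y) →
    (N N' : Mat n) →
    IsInverse (pertMatrix G s m us vs) N →
    IsInverse (pertMatrix G s m (λ i → σ (us i)) (λ i → σ (vs i))) N' →
    N ur vr ≈ᶠ N' (σ ur) (σ vr)
mainTheorem9 G 1wr s m us vs ur vr K K′ K-clique K′-clique us∈K vs∈K ur∈K vr∈K σ σ-maps σ-injective N N′ N-inv N′-inv =
  proportional-cleared⇒≈ᶠ (N ur) (N′ (σ ur)) (proj₁ N-inv ur) (proj₁ N′-inv (σ ur)) vr (σ vr) (begin
    Yσ.c * Y.x̃ vr        ≈⟨ *-congˡ {Yσ.c} (Y.Y-zero vr) ⟨
    Yσ.c * Y.Y 0 vr      ≈⟨ Y-proportional ⟩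
    Y.c * Yσ.Y 0 (σ vr)  ≈⟨ *-congˡ {Y.c} (Yσ.Y-zero (σ vr)) ⟩
    Y.c * Yσ.x̃ (σ vr)    ∎)
  where
  d = degree G ur
  regular : ∀ x → degree G x ≡ d
  regular x = Walks.walkRegular⇒regular G (proj₁ 1wr) x ur
  module Y  = Row G d regular s m us vs N N-inv ur
  module Yσ = Row G d regular s m (σ ∘ us) (σ ∘ vs) N′ N′-inv (σ ur)
  open CliqueEmbedding G 1wr K K′ K-clique K′-clique σ σ-maps σ-injective using (B^-σ)
  Y-proportional : Yσ.c * Y.Y 0 vr ≈ Y.c * Yσ.Y 0 (σ vr)
  Y-proportional = bounded-solutions-agree Y.c Yσ.c
    (λ L → (Perturbation.B G d s m us vs ^ᴹ L) ur vr) (λ L → (Perturbation.B G d s m (σ ∘ us) (σ ∘ vs) ^ᴹ L) (σ ur) (σ vr))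
    (λ L → Y.Y L vr) (λ L → Yσ.Y L (σ vr)) (λ L → B^-σ d s us vs us∈K vs∈K L ur∈K vr∈K)
    (λ L → Y.Y-suc L vr) (λ L → Yσ.Y-suc L (σ vr))
    (λ L → proj₂ Y.Y-bounded L vr) (λ L → proj₂ Yσ.Y-bounded L (σ vr))
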